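{- Let $\pi\prec\sigma$ be a cover relation in the poset $\mathrm{NC}^d_n$. Then $\sigma$ is obtained from $\pi$ by merging exactly $d+1$ blocks of $\pi$ into one block (all other blocks unchanged).
   Context: A partition of $[n]$ is noncrossing if there are no $i<j<k<\ell$ with $i,k$ in one block and $j,\ell$ in a different block. The Kreweras dual $\pi'$ of a noncrossing partition $\pi$ of $[n]$: place $1,1',2,2',\dots,n,n'$ on a circle in this cyclic order; $\pi'$ is the coarsest partition of $\{1',\dots,n'\}$ such that the blocks of $\pi$ and of $\pi'$ together form a noncrossing partition of these $2n$ points. $\mathrm{NC}^d_n$ is the poset, ordered by refinement, of noncrossing partitions $\pi$ of $[n]$ such that every block of $\pi$ and of $\pi'$ has cardinality congruent to $1$ modulo $d$. -}

module Defs where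

open import Data.Nat using (ℕ; zero; suc; _+_; _*_; _<_)
open import Data.Nat.Properties using (_≟_)
open import Data.Fin using (Fin; toℕ)
open import Data.List using (length; filter; allFin)
open import Data.Sum using (_⊎_; inj₁; inj₂)
open import Data.Product using (Σ; ∃; _×_)
open import Data.Empty using (⊥)
open import Relation.Nullary using (¬_)
open import Relation.Binary.PropositionalEquality using (_≡_)
open import Function.Bundles using (_⇔_)

-- A set partition of [n] = {0,…,n-1} is given by a block labelling:
-- i and j lie in the same block iff their labels coincide.
Partition : ℕ → Set
Partition n = Fin n → ℕ

SameBlock : ∀ {n} → Partition n → Fin n → Fin n → Set
SameBlock π i j = π i ≡ π j

Refines : ∀ {n} → Partition n → Partition n → Set
Refines π σ = ∀ i j → SameBlock π i j → SameBlock σ i j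

-- A "same block" relation on points X placed at positions pos on a line
-- (equivalently a circle, read from a cut point) is noncrossing if there are
-- no a < b < c < e with a,c in one block and b,e in a different block.
NoncrossingOn : {X : Set} → (X → ℕ) → (X → X → Set) → Set
NoncrossingOn {X} pos same =
  (a b c e : X) → pos a < pos b → pos b < pos c → pos c < pos e →
  ¬ (same a c × same b e × ¬ same a b)

Noncrossing : ∀ {n} → Partition n → Set
Noncrossing {n} π = NoncrossingOn toℕ (SameBlock π)

-- The 2n points 1,1',2,2',…,n,n' : inj₁ i is the point i, inj₂ i is i'.
circlePos : ∀ {n} → Fin n ⊎ Fin n → ℕ
circlePos (inj₁ i) = 2 * toℕ i
circlePos (inj₂ i) = suc (2 * toℕ i)

Joint : ∀ {n} → Partition n → Partition n → Fin n ⊎ Fin n → Fin n ⊎ Fin n → Set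
Joint π ρ (inj₁ i) (inj₁ j) = SameBlock π i j
Joint π ρ (inj₂ i) (inj₂ j) = SameBlock ρ i j
Joint π ρ (inj₁ i) (inj₂ j) = ⊥
Joint π ρ (inj₂ i) (inj₁ j) = ⊥

JointNoncrossing : ∀ {n} → Partition n → Partition n → Set
JointNoncrossing π ρ = NoncrossingOn circlePos (Joint π ρ)

IsKrewerasDual : ∀ {n} → Partition n → Partition n → Set
IsKrewerasDual π ρ =
  JointNoncrossing π ρ × (∀ ρ' → JointNoncrossing π ρ' → Refines ρ' ρ)

blockSize : ∀ {n} → Partition n → Fin n → ℕ
blockSize {n} π i = length (filter (λ j → π j ≟ π i) (allFin n))

BlocksOneModD : ∀ {n} → ℕ → Partition n → Set
BlocksOneModD d π = ∀ i → ∃ λ q → blockSize π i ≡ 1 + q * d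

NCd : (d n : ℕ) → Partition n → Set
NCd d n π =
  Noncrossing π × BlocksOneModD d π ×
  Σ (Partition n) (λ ρ → IsKrewerasDual π ρ × BlocksOneModD d ρ)

StrictlyRefines : ∀ {n} → Partition n → Partition n → Set
StrictlyRefines π σ = Refines π σ × ¬ Refines σ π

Covers : (d n : ℕ) → Partition n → Partition n → Set
Covers d n π σ =
  NCd d n π × NCd d n σ × StrictlyRefines π σ ×
  (∀ τ → NCd d n τ → Refines π τ → Refines τ σ → Refines τ π ⊎ Refines σ τ)

MergesBlocks : ∀ {n} → ℕ → Partition n → Partition n → Set
MergesBlocks {n} k π σ =
  Σ (Fin k → Fin n) λ b →
    (∀ x y → SameBlock π (b x) (b y) → x ≡ y) ×
    (∀ i j → SameBlock σ i j ⇔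
       (SameBlock π i j ⊎
        ((∃ λ x → SameBlock π i (b x)) × (∃ λ y → SameBlock π j (b y)))))

-- For a noncrossing π whose blocks all have size ≡ 1 (mod d), the blocks of the Kreweras dual
-- all have size ≡ 1 iff n ≡ 1 and consecutive elements x < y of each block satisfy y ≡ x + 1.
-- Indeed, a union of blocks forming an interval has length ≡ its number of closed prefixes, and
-- the dual block of x′ consists of x′ and one point per closed prefix of the gap after x.
--
-- Let π ≺ σ be a cover and S a block of σ containing two blocks of π. Inside S one finds d + 1
-- blocks of π such that consecutive elements of their union are separated by closed gaps of
-- length ≡ 0, so merging them gives τ ∈ NC^d_n with π < τ ≤ σ; hence τ = σ.

module Submission where

open import Defs
open import Data.Nat using (ℕ; zero; suc; _+_; _*_; _∸_; _≤_; _<_; z≤n; s≤s; z<s; _≤?_; _<?_; _≟_; >-nonZero)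
open import Data.Nat.Properties
open import Data.Nat.Tactic.RingSolver using (solve-∀)
open import Data.Fin using (Fin; toℕ; fromℕ<) renaming (zero to fz; suc to fs)
open import Data.Fin.Properties using (toℕ-fromℕ<; fromℕ<-toℕ; toℕ<n; any?; all?; ¬∀⟶∃¬) renaming (suc-injective to fs-injective)
open import Data.List using (length; filter; allFin; tabulate)
open import Data.Product using (∃; ∃₂; _×_; _,_; proj₁; proj₂) renaming (map to ×-map)
open import Data.Sum using (_⊎_; inj₁; inj₂; [_,_]′) renaming (map to ⊎-map)
open import Data.Empty using (⊥-elim)
open import Function using (_∘_; id; case_of_)
open import Function.Bundles using (_⇔_; mk⇔; Equivalence)
open import Relation.Binary.PropositionalEquality
open import Relation.Binary.Definitions using (tri<; tri≈; tri>)
open import Relation.Nullary using (¬_; Dec; yes; no; contradiction)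
open import Relation.Nullary.Decidable using (_×-dec_; _→-dec_)
open import Relation.Unary using (Decidable)
open import Relation.Binary.Bundles using (Setoid)
import Relation.Binary.Reasoning.Setoid as SetoidReasoning
open import Level using (0ℓ)

infix 4 _≡_mod_
record _≡_mod_ (a b d : ℕ) : Set where
  constructor congruent
  field
    k l : ℕ
    eq : a + k * d ≡ b + l * d

private
  +-*-shuffle : ∀ x m m' d → x + (m + m') * d ≡ (x + m * d) + m' * d
  +-*-shuffle = solve-∀

  +-rightComm : ∀ x y z → (x + y) + z ≡ (x + z) + y
  +-rightComm = solve-∀

  +-interchange : ∀ a b c e → (a + b) + (c + e) ≡ (a + c) + (b + e)
  +-interchange = solve-∀

  +-*-interchange : ∀ a c m m' d → (a + c) + (m + m') * d ≡ (a + m * d) + (c + m' * d)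
  +-*-interchange = solve-∀

module _ {d : ℕ} where

  ≡⇒≡-mod : ∀ {a b} → a ≡ b → a ≡ b mod d
  ≡⇒≡-mod refl = congruent 0 0 refl

  ≡-mod-refl : ∀ {a} → a ≡ a mod d
  ≡-mod-refl = ≡⇒≡-mod refl

  ≡-mod-sym : ∀ {a b} → a ≡ b mod d → b ≡ a mod d
  ≡-mod-sym (congruent k l eq) = congruent l k (sym eq)

  ≡-mod-trans : ∀ {a b c} → a ≡ b mod d → b ≡ c mod d → a ≡ c mod d
  ≡-mod-trans {a} {b} {c} (congruent k l p) (congruent k' l' q) = congruent (k + k') (l' + l) (begin
    a + (k + k') * d     ≡⟨ +-*-shuffle a k k' d ⟩
    (a + k * d) + k' * d ≡⟨ cong (_+ k' * d) p ⟩
    (b + l * d) + k' * d ≡⟨ +-rightComm b (l * d) (k' * d) ⟩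
    (b + k' * d) + l * d ≡⟨ cong (_+ l * d) q ⟩
    (c + l' * d) + l * d ≡⟨ +-*-shuffle c l' l d ⟨
    c + (l' + l) * d     ∎)
    where open ≡-Reasoning

  +-cong-mod : ∀ {a b c e} → a ≡ b mod d → c ≡ e mod d → a + c ≡ b + e mod d
  +-cong-mod {a} {b} {c} {e} (congruent k l p) (congruent k' l' q) = congruent (k + k') (l + l') (begin
    (a + c) + (k + k') * d     ≡⟨ +-*-interchange a c k k' d ⟩
    (a + k * d) + (c + k' * d) ≡⟨ cong₂ _+_ p q ⟩
    (b + l * d) + (e + l' * d) ≡⟨ +-*-interchange b e l l' d ⟨
    (b + e) + (l + l') * d     ∎)
    where open ≡-Reasoning

  +-cancelʳ-mod : ∀ {a b} c → a + c ≡ b + c mod d → a ≡ b mod d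
  +-cancelʳ-mod {a} {b} c (congruent k l p) = congruent k l (+-cancelʳ-≡ c _ _ (begin
    (a + k * d) + c ≡⟨ +-rightComm a (k * d) c ⟩
    (a + c) + k * d ≡⟨ p ⟩
    (b + c) + l * d ≡⟨ +-rightComm b (l * d) c ⟨
    (b + l * d) + c ∎))
    where open ≡-Reasoning

  +-cancelˡ-mod : ∀ {a b} c → c + a ≡ c + b mod d → a ≡ b mod d
  +-cancelˡ-mod {a} {b} c = +-cancelʳ-mod c ∘ subst₂ (λ x y → x ≡ y mod d) (+-comm c a) (+-comm c b)

  d≡0-mod : d ≡ 0 mod d
  d≡0-mod = congruent 0 1 (trans (+-identityʳ d) (sym (+-identityʳ d)))

  ≡0-mod⇒d≤ : ∀ {k} → 0 < k → k ≡ 0 mod d → d ≤ k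
  ≡0-mod⇒d≤ {k} 0<k (congruent a b eq) with a <? b
  ... | no b≤a = contradiction 0<k (≤⇒≯ (+-cancelʳ-≤ (a * d) k 0 (begin
    k + a * d ≡⟨ eq ⟩
    b * d     ≤⟨ *-monoˡ-≤ d (≮⇒≥ b≤a) ⟩
    a * d     ∎)))
    where open ≤-Reasoning
  ... | yes a<b = subst (d ≤_) (sym k≡) (m≤m+n d (c * d))
    where
      open ≡-Reasoning
      c : ℕ
      c = b ∸ suc a
      expand : ∀ a c d → (suc a + c) * d ≡ (d + c * d) + a * d
      expand = solve-∀
      k≡ : k ≡ d + c * d
      k≡ = +-cancelʳ-≡ (a * d) k (d + c * d) (begin
        k + a * d           ≡⟨ eq ⟩
        b * d               ≡⟨ cong (_* d) (m+[n∸m]≡n a<b) ⟨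
        (suc a + c) * d     ≡⟨ expand a c d ⟩
        (d + c * d) + a * d ∎)

  ≡-mod-setoid : Setoid 0ℓ 0ℓ
  ≡-mod-setoid = record
    { Carrier = ℕ ; _≈_ = λ a b → a ≡ b mod d
    ; isEquivalence = record { refl = ≡-mod-refl ; sym = ≡-mod-sym ; trans = ≡-mod-trans } }

  module ≡-mod-Reasoning = SetoidReasoning ≡-mod-setoid

  1+q*d⇒≡1-mod : ∀ {a} → (∃ λ q → a ≡ 1 + q * d) → a ≡ 1 mod d
  1+q*d⇒≡1-mod (q , refl) = congruent 0 q (+-identityʳ _)

  ≡1-mod⇒1+q*d : ∀ {a} → 0 < a → a ≡ 1 mod d → ∃ λ q → a ≡ 1 + q * d
  ≡1-mod⇒1+q*d {suc a} _ (congruent k l eq) = l ∸ k , cong suc (begin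
    a                 ≡⟨ m+n∸n≡m a (k * d) ⟨
    a + k * d ∸ k * d ≡⟨ cong (_∸ k * d) (suc-injective eq) ⟩
    l * d ∸ k * d     ≡⟨ *-distribʳ-∸ d l k ⟨
    (l ∸ k) * d       ∎)
    where open ≡-Reasoning

module Count {P : ℕ → Set} (P? : Decidable P) where

  indicator : ℕ → ℕ
  indicator x with P? x
  ... | yes _ = 1
  ... | no _  = 0

  indicator-yes : ∀ {x} → P x → indicator x ≡ 1
  indicator-yes {x} p with P? x
  ... | yes _ = refl
  ... | no ¬p = contradiction p ¬p

  indicator-no : ∀ {x} → ¬ P x → indicator x ≡ 0
  indicator-no {x} ¬p with P? x
  ... | yes p = contradiction p ¬p
  ... | no _  = refl

  countFrom : ℕ → ℕ → ℕ
  countFrom zero    s = 0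
  countFrom (suc k) s = indicator s + countFrom k (suc s)

  count : ℕ → ℕ → ℕ
  count a b = countFrom (b ∸ a) a

  countFrom-+ : ∀ k l s → countFrom (k + l) s ≡ countFrom k s + countFrom l (s + k)
  countFrom-+ zero    l s = cong (countFrom l) (sym (+-identityʳ s))
  countFrom-+ (suc k) l s = begin
    indicator s + countFrom (k + l) (suc s)                       ≡⟨ cong (indicator s +_) (countFrom-+ k l (suc s)) ⟩
    indicator s + (countFrom k (suc s) + countFrom l (suc s + k)) ≡⟨ +-assoc (indicator s) _ _ ⟨
    countFrom (suc k) s + countFrom l (suc s + k)                 ≡⟨ cong (λ t → countFrom (suc k) s + countFrom l t) (+-suc s k) ⟨
    countFrom (suc k) s + countFrom l (s + suc k)                 ∎
    where open ≡-Reasoning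

  count-split : ∀ {a m b} → a ≤ m → m ≤ b → count a b ≡ count a m + count m b
  count-split {a} {m} {b} a≤m m≤b = begin
    countFrom (b ∸ a) a                               ≡⟨ cong (λ k → countFrom k a) b∸a ⟩
    countFrom ((m ∸ a) + (b ∸ m)) a                   ≡⟨ countFrom-+ (m ∸ a) (b ∸ m) a ⟩
    countFrom (m ∸ a) a + countFrom (b ∸ m) (a + (m ∸ a)) ≡⟨ cong (λ s → count a m + countFrom (b ∸ m) s) (m+[n∸m]≡n a≤m) ⟩
    count a m + count m b                             ∎
    where
      open ≡-Reasoning
      b∸a : b ∸ a ≡ (m ∸ a) + (b ∸ m)
      b∸a = trans (cong (_∸ a) (sym (m+[n∸m]≡n m≤b))) (+-∸-comm (b ∸ m) a≤m)

  count-empty : ∀ a → count a a ≡ 0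
  count-empty a = cong (λ k → countFrom k a) (n∸n≡0 a)

  count-singleton : ∀ a → count a (suc a) ≡ indicator a
  count-singleton a = trans (cong (λ k → countFrom k a) (m+n∸n≡m 1 a)) (+-identityʳ (indicator a))

  count-splitAt : ∀ {a p b} → a ≤ p → p < b → count a b ≡ count a p + (indicator p + count (suc p) b)
  count-splitAt {a} {p} {b} a≤p p<b = begin
    count a b                               ≡⟨ count-split a≤p (<⇒≤ p<b) ⟩
    count a p + count p b                   ≡⟨ cong (count a p +_) (count-split (n≤1+n p) p<b) ⟩
    count a p + (count p (suc p) + count (suc p) b) ≡⟨ cong (λ c → count a p + (c + count (suc p) b)) (count-singleton p) ⟩
    count a p + (indicator p + count (suc p) b) ∎
    where open ≡-Reasoning

  countFrom-none : ∀ k s → (∀ x → s ≤ x → x < s + k → ¬ P x) → countFrom k s ≡ 0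
  countFrom-none zero    s none = refl
  countFrom-none (suc k) s none = cong₂ _+_
    (indicator-no (none s ≤-refl (m<m+n s z<s)))
    (countFrom-none k (suc s) λ x s<x x<s+k → none x (<⇒≤ s<x) (subst (x <_) (sym (+-suc s k)) x<s+k))

  count-none : ∀ a b → (∀ x → a ≤ x → x < b → ¬ P x) → count a b ≡ 0
  count-none a b none with a ≤? b
  ... | yes a≤b = countFrom-none (b ∸ a) a λ x a≤x x<b → none x a≤x (subst (x <_) (m+[n∸m]≡n a≤b) x<b)
  ... | no a≰b  = cong (λ k → countFrom k a) (m≤n⇒m∸n≡0 (<⇒≤ (≰⇒> a≰b)))

  count-unique : ∀ {a p b} → a ≤ p → p < b → P p → (∀ x → a ≤ x → x < b → x ≢ p → ¬ P x) → count a b ≡ 1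
  count-unique {a} {p} {b} a≤p p<b pp others = begin
    count a b                                  ≡⟨ count-splitAt a≤p p<b ⟩
    count a p + (indicator p + count (suc p) b) ≡⟨ cong₂ (λ u v → u + (v + count (suc p) b)) below (indicator-yes pp) ⟩
    0 + (1 + count (suc p) b)                  ≡⟨ cong suc above ⟩
    1                                          ∎
    where
      open ≡-Reasoning
      below : count a p ≡ 0
      below = count-none a p λ x a≤x x<p → others x a≤x (<-trans x<p p<b) (<⇒≢ x<p)
      above : count (suc p) b ≡ 0
      above = count-none (suc p) b λ x p<x x<b → others x (≤-trans a≤p (<⇒≤ p<x)) x<b (≢-sym (<⇒≢ p<x))

module _ {P Q : ℕ → Set} (P? : Decidable P) (Q? : Decidable Q) where
  private
    module CP = Count P?
    module CQ = Count Q?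

  indicator-cong : ∀ {x} → P x ⇔ Q x → CP.indicator x ≡ CQ.indicator x
  indicator-cong {x} P⇔Q with P? x | Q? x
  ... | yes _ | yes _ = refl
  ... | no _  | no _  = refl
  ... | yes p | no ¬q = contradiction (Equivalence.to P⇔Q p) ¬q
  ... | no ¬p | yes q = contradiction (Equivalence.from P⇔Q q) ¬p

  countFrom-cong : ∀ k s → (∀ x → s ≤ x → x < s + k → P x ⇔ Q x) → CP.countFrom k s ≡ CQ.countFrom k s
  countFrom-cong zero    s P⇔Q = refl
  countFrom-cong (suc k) s P⇔Q = cong₂ _+_
    (indicator-cong (P⇔Q s ≤-refl (m<m+n s z<s)))
    (countFrom-cong k (suc s) λ x s<x x<s+k → P⇔Q x (<⇒≤ s<x) (subst (x <_) (sym (+-suc s k)) x<s+k))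

  count-cong : ∀ a b → (∀ x → a ≤ x → x < b → P x ⇔ Q x) → CP.count a b ≡ CQ.count a b
  count-cong a b P⇔Q with a ≤? b
  ... | yes a≤b = countFrom-cong (b ∸ a) a λ x a≤x x<b → P⇔Q x a≤x (subst (x <_) (m+[n∸m]≡n a≤b) x<b)
  ... | no a≰b  = trans (cong (λ k → CP.countFrom k a) b∸a≡0) (cong (λ k → CQ.countFrom k a) (sym b∸a≡0))
    where
      b∸a≡0 : b ∸ a ≡ 0
      b∸a≡0 = m≤n⇒m∸n≡0 (<⇒≤ (≰⇒> a≰b))

module _ {P Q U : ℕ → Set} (P? : Decidable P) (Q? : Decidable Q) (U? : Decidable U)
         (U⇔P⊎Q : ∀ x → U x ⇔ (P x ⊎ Q x)) (disjoint : ∀ x → P x → ¬ Q x) where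
  private
    module CP = Count P?
    module CQ = Count Q?
    module CU = Count U?

  indicator-⊎ : ∀ x → CU.indicator x ≡ CP.indicator x + CQ.indicator x
  indicator-⊎ x with U? x | P? x | Q? x
  ... | _     | yes p | yes q = contradiction q (disjoint x p)
  ... | yes _ | yes _ | no _  = refl
  ... | yes _ | no _  | yes _ = refl
  ... | yes u | no ¬p | no ¬q = ⊥-elim ([ ¬p , ¬q ]′ (Equivalence.to (U⇔P⊎Q x) u))
  ... | no ¬u | yes p | no _  = contradiction (Equivalence.from (U⇔P⊎Q x) (inj₁ p)) ¬u
  ... | no ¬u | no _  | yes q = contradiction (Equivalence.from (U⇔P⊎Q x) (inj₂ q)) ¬u
  ... | no _  | no _  | no _  = refl

  countFrom-⊎ : ∀ k s → CU.countFrom k s ≡ CP.countFrom k s + CQ.countFrom k s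
  countFrom-⊎ zero    s = refl
  countFrom-⊎ (suc k) s = begin
    CU.indicator s + CU.countFrom k (suc s)
      ≡⟨ cong₂ _+_ (indicator-⊎ s) (countFrom-⊎ k (suc s)) ⟩
    (CP.indicator s + CQ.indicator s) + (CP.countFrom k (suc s) + CQ.countFrom k (suc s))
      ≡⟨ +-interchange (CP.indicator s) (CQ.indicator s) (CP.countFrom k (suc s)) (CQ.countFrom k (suc s)) ⟩
    CP.countFrom (suc k) s + CQ.countFrom (suc k) s
      ∎
    where open ≡-Reasoning

  count-⊎ : ∀ a b → CU.count a b ≡ CP.count a b + CQ.count a b
  count-⊎ a b = countFrom-⊎ (b ∸ a) a

module _ {n : ℕ} {P : Fin n → Set} (P? : Decidable P) {Q : ℕ → Set} (Q? : Decidable Q)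
         (P⇔Q : ∀ j → P j ⇔ Q (toℕ j)) where
  open Count Q?

  private
    length-filter-tabulate : ∀ m (f : Fin m → Fin n) s → (∀ i → toℕ (f i) ≡ toℕ i + s) →
                             length (filter P? (tabulate f)) ≡ countFrom m s
    length-filter-tabulate zero    f s f≗ = refl
    length-filter-tabulate (suc m) f s f≗ with P? (f fz) | length-filter-tabulate m (f ∘ fs) (suc s) (λ i → trans (f≗ (fs i)) (sym (+-suc (toℕ i) s)))
    ... | yes p | rest = cong₂ _+_ (sym (indicator-yes (subst Q (f≗ fz) (Equivalence.to (P⇔Q (f fz)) p)))) rest
    ... | no ¬p | rest = cong₂ _+_ (sym (indicator-no λ q → ¬p (Equivalence.from (P⇔Q (f fz)) (subst Q (sym (f≗ fz)) q)))) rest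

  length-filter-allFin : length (filter P? (allFin n)) ≡ count 0 n
  length-filter-allFin = length-filter-tabulate n id 0 λ i → sym (+-identityʳ (toℕ i))

NoneBelow : (ℕ → Set) → ℕ → Set
NoneBelow P k = ∀ j → j < k → ¬ P j

record Least (P : ℕ → Set) (k : ℕ) : Set where
  field
    min       : ℕ
    P-min     : P min
    min<      : min < k
    below-min : NoneBelow P min

  min≤ : ∀ {j} → P j → min ≤ j
  min≤ {j} pj = ≮⇒≥ λ j<min → below-min j j<min pj

record Greatest (P : ℕ → Set) (k : ℕ) : Set where
  field
    max       : ℕ
    P-max     : P max
    max<      : max < k
    above-max : ∀ j → max < j → j < k → ¬ P j

  ≤max : ∀ {j} → j < k → P j → j ≤ max
  ≤max {j} j<k pj = ≮⇒≥ λ max<j → above-max j max<j j<k pj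

module Search {P : ℕ → Set} (P? : Decidable P) where

  private
    extendNone : ∀ {k} → NoneBelow P k → ¬ P k → NoneBelow P (suc k)
    extendNone {k} none ¬pk j j<1+k with m<1+n⇒m<n∨m≡n j<1+k
    ... | inj₁ j<k  = none j j<k
    ... | inj₂ refl = ¬pk

  opaque
    least< : ∀ k → NoneBelow P k ⊎ Least P k
    least< zero = inj₁ λ _ ()
    least< (suc k) with least< k
    ... | inj₂ l = inj₂ record { Least l ; min< = m<n⇒m<1+n (Least.min< l) }
    ... | inj₁ none with P? k
    ...   | yes pk = inj₂ record { min = k ; P-min = pk ; min< = ≤-refl ; below-min = none }
    ...   | no ¬pk = inj₁ (extendNone none ¬pk)

    greatest< : ∀ k → NoneBelow P k ⊎ Greatest P k
    greatest< zero = inj₁ λ _ ()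
    greatest< (suc k) with P? k
    ... | yes pk = inj₂ record { max = k ; P-max = pk ; max< = ≤-refl ; above-max = λ j k<j j≤k → ⊥-elim (<⇒≱ k<j (≤-pred j≤k)) }
    ... | no ¬pk with greatest< k
    ...   | inj₁ none = inj₁ (extendNone none ¬pk)
    ...   | inj₂ g = inj₂ record { Greatest g ; max< = m<n⇒m<1+n (Greatest.max< g) ; above-max = above }
      where
        open Greatest g using (max; above-max)
        above : ∀ j → max < j → j < suc k → ¬ P j
        above j max<j j<1+k with m<1+n⇒m<n∨m≡n j<1+k
        ... | inj₁ j<k  = above-max j max<j j<k
        ... | inj₂ refl = ¬pk

  least : ∀ {k} → P k → Least P (suc k)
  least {k} pk with least< (suc k)
  ... | inj₁ none = contradiction pk (none k ≤-refl)
  ... | inj₂ l    = l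

between-neighbours : ∀ {P : ℕ → Set} {p k} (g : Greatest P p) (l : Least (λ z → p < z × P z) k) →
                     ¬ P p → ∀ z → Greatest.max g < z → z < Least.min l → ¬ P z
between-neighbours {p = p} g l ¬pp z g<z z<l pz with <-cmp z p
... | tri< z<p _ _  = Greatest.above-max g z g<z z<p pz
... | tri≈ _ refl _ = ¬pp pz
... | tri> _ _ p<z  = Least.below-min l z z<l (p<z , pz)

-- A partition of [n] is extended to ℕ by making every x ≥ n a singleton: blocks of π get even
-- labels and the singletons odd ones.
module OnNat {n : ℕ} (π : Partition n) where

  opaque
    label : ℕ → ℕ
    label x with x <? n
    ... | yes x<n = 2 * π (fromℕ< x<n)
    ... | no _    = suc (2 * x)

    label-< : ∀ {x} (x<n : x < n) → label x ≡ 2 * π (fromℕ< x<n)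
    label-< {x} x<n with x <? n
    ... | yes _   = refl
    ... | no x≮n  = contradiction x<n x≮n

    label-≥ : ∀ {x} → ¬ x < n → label x ≡ suc (2 * x)
    label-≥ {x} x≮n with x <? n
    ... | yes x<n = contradiction x<n x≮n
    ... | no _    = refl

  label-toℕ : ∀ i → label (toℕ i) ≡ 2 * π i
  label-toℕ i = trans (label-< (toℕ<n i)) (cong (λ j → 2 * π j) (fromℕ<-toℕ i (toℕ<n i)))

  infix 4 _~_
  _~_ : ℕ → ℕ → Set
  x ~ y = label x ≡ label y

  _~?_ : ∀ x y → Dec (x ~ y)
  x ~? y = label x ≟ label y

  ~-refl : ∀ {x} → x ~ x
  ~-refl = refl

  ~-sym : ∀ {x y} → x ~ y → y ~ x
  ~-sym = sym

  ~-trans : ∀ {x y z} → x ~ y → y ~ z → x ~ z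
  ~-trans = trans

  ~-toℕ : ∀ i j → π i ≡ π j → toℕ i ~ toℕ j
  ~-toℕ i j eq = trans (label-toℕ i) (trans (cong (2 *_) eq) (sym (label-toℕ j)))

  toℕ-~ : ∀ i j → toℕ i ~ toℕ j → π i ≡ π j
  toℕ-~ i j eq = *-cancelˡ-≡ (π i) (π j) 2 (trans (sym (label-toℕ i)) (trans eq (label-toℕ j)))

  ~-<n : ∀ {x y} → x < n → x ~ y → y < n
  ~-<n {x} {y} x<n x~y with y <? n
  ... | yes y<n = y<n
  ... | no y≮n  = ⊥-elim (even≢odd (π (fromℕ< x<n)) y (trans (sym (label-< x<n)) (trans x~y (label-≥ y≮n))))

  ~-≥n : ∀ {x y} → ¬ x < n → x ~ y → x ≡ y
  ~-≥n {x} {y} x≮n x~y with y <? n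
  ... | yes y<n = ⊥-elim (even≢odd (π (fromℕ< y<n)) x (trans (sym (label-< y<n)) (trans (sym x~y) (label-≥ x≮n))))
  ... | no y≮n  = *-cancelˡ-≡ x y 2 (suc-injective (trans (sym (label-≥ x≮n)) (trans x~y (label-≥ y≮n))))

  ~-≢⇒<n : ∀ {x y} → x ~ y → x ≢ y → x < n
  ~-≢⇒<n {x} x~y x≢y with x <? n
  ... | yes x<n = x<n
  ... | no x≮n  = contradiction (~-≥n x≮n x~y) x≢y

  Closed : ℕ → ℕ → Set
  Closed a b = ∀ x y → x ~ y → a ≤ x → x < b → a ≤ y × y < b

  Closed? : ∀ a b → Dec (Closed a b)
  Closed? a b with allUpTo? (λ x → (a ≤? x) →-dec allUpTo? (λ y → (x ~? y) →-dec ((a ≤? y) ×-dec (y <? b))) n) b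
  ... | no ¬closed = no λ closed → ¬closed λ {x} x<b a≤x {y} _ x~y → closed x y x~y a≤x x<b
  ... | yes closed = yes λ x y x~y a≤x x<b → case x <? n of λ where
      (yes x<n) → closed x<b a≤x (~-<n x<n x~y) x~y
      (no x≮n)  → subst (λ z → a ≤ z × z < b) (~-≥n x≮n x~y) (a≤x , x<b)

  Closed-empty : ∀ a → Closed a a
  Closed-empty a x y x~y a≤x x<a = ⊥-elim (<-irrefl refl (≤-<-trans a≤x x<a))

  Closed-∪ : ∀ {a m b} → a ≤ m → m ≤ b → Closed a m → Closed m b → Closed a b
  Closed-∪ {a} {m} {b} a≤m m≤b left right x y x~y a≤x x<b with x <? m
  ... | yes x<m = let a≤y , y<m = left x y x~y a≤x x<m in a≤y , <-≤-trans y<m m≤b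
  ... | no x≮m  = let m≤y , y<b = right x y x~y (≮⇒≥ x≮m) x<b in ≤-trans a≤m m≤y , y<b

  Closed-∖ˡ : ∀ {a m b} → a ≤ m → Closed a b → Closed a m → Closed m b
  Closed-∖ˡ {a} {m} {b} a≤m whole left x y x~y m≤x x<b with whole x y x~y (≤-trans a≤m m≤x) x<b
  ... | a≤y , y<b with m ≤? y
  ...   | yes m≤y = m≤y , y<b
  ...   | no m≰y  = ⊥-elim (<⇒≱ (proj₂ (left y x (~-sym x~y) a≤y (≰⇒> m≰y))) m≤x)

  Closed-∖ʳ : ∀ {a m b} → m ≤ b → Closed a b → Closed m b → Closed a m
  Closed-∖ʳ {a} {m} {b} m≤b whole right x y x~y a≤x x<m with whole x y x~y a≤x (<-≤-trans x<m m≤b)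
  ... | a≤y , y<b with y <? m
  ...   | yes y<m = a≤y , y<m
  ...   | no y≮m  = ⊥-elim (<⇒≱ x<m (proj₁ (right y x (~-sym x~y) (≮⇒≥ y≮m) y<b)))

  Closed-all : Closed 0 n
  Closed-all x y x~y _ x<n = z≤n , ~-<n x<n x~y

  NoncrossingOnℕ : Set
  NoncrossingOnℕ = ∀ a b c e → a < b → b < c → c < e → a ~ c → b ~ e → a ~ b

  noncrossing⇒onℕ : Noncrossing π → NoncrossingOnℕ
  noncrossing⇒onℕ nc a b c e a<b b<c c<e a~c b~e with a ~? b
  ... | yes a~b = a~b
  ... | no a≁b  = ⊥-elim (nc (fromℕ< a<n) (fromℕ< b<n) (fromℕ< c<n) (fromℕ< e<n)
                     (subst₂ _<_ (sym (toℕ-fromℕ< a<n)) (sym (toℕ-fromℕ< b<n)) a<b)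
                     (subst₂ _<_ (sym (toℕ-fromℕ< b<n)) (sym (toℕ-fromℕ< c<n)) b<c)
                     (subst₂ _<_ (sym (toℕ-fromℕ< c<n)) (sym (toℕ-fromℕ< e<n)) c<e)
                     (toℕ-~ _ _ (subst₂ _~_ (sym (toℕ-fromℕ< a<n)) (sym (toℕ-fromℕ< c<n)) a~c) ,
                      toℕ-~ _ _ (subst₂ _~_ (sym (toℕ-fromℕ< b<n)) (sym (toℕ-fromℕ< e<n)) b~e) ,
                      λ same → a≁b (subst₂ _~_ (toℕ-fromℕ< a<n) (toℕ-fromℕ< b<n) (~-toℕ _ _ same))))
    where
      a<n : a < n
      a<n = ~-≢⇒<n a~c (<⇒≢ (<-trans a<b b<c))
      c<n : c < n
      c<n = ~-<n a<n a~c
      b<n : b < n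
      b<n = ~-≢⇒<n b~e (<⇒≢ (<-trans b<c c<e))
      e<n : e < n
      e<n = ~-<n b<n b~e

  onℕ⇒noncrossing : NoncrossingOnℕ → Noncrossing π
  onℕ⇒noncrossing nc a b c e a<b b<c c<e (a~c , b~e , a≁b) =
    a≁b (toℕ-~ a b (nc _ _ _ _ a<b b<c c<e (~-toℕ a c a~c) (~-toℕ b e b~e)))

  module _ (nc : NoncrossingOnℕ) where

    Closed-hull : ∀ {u e} → e ~ u → (∀ z → z ~ u → u ≤ z × z ≤ e) → Closed u (suc e)
    Closed-hull {u} {e} e~u bounds x y x~y u≤x x≤e with x ~? u
    ... | yes x~u = let u≤y , y≤e = bounds y (~-trans (~-sym x~y) x~u) in u≤y , s≤s y≤e
    ... | no x≁u = inside (≤∧≢⇒< u≤x λ u≡x → x≁u (cong label (sym u≡x)))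
                          (≤∧≢⇒< (≤-pred x≤e) λ x≡e → x≁u (trans (cong label x≡e) e~u))
      where
        inside : u < x → x < e → u ≤ y × y < suc e
        inside u<x x<e with u ≤? y | y ≤? e
        ... | yes u≤y | yes y≤e = u≤y , s≤s y≤e
        ... | no u≰y  | _       = ⊥-elim (x≁u (~-trans x~y (nc y u x e (≰⇒> u≰y) u<x x<e (~-sym x~y) (~-sym e~u))))
        ... | yes _   | no y≰e  = ⊥-elim (x≁u (~-sym (nc u x e y u<x x<e (≰⇒> y≰e) (~-sym e~u) x~y)))

    Closed-gap : ∀ {x y} → x < y → x ~ y → (∀ z → x < z → z < y → ¬ z ~ x) → Closed (suc x) y
    Closed-gap {x} {y} x<y x~y between a b a~b x<a a<y with a ~? x
    ... | yes a~x = ⊥-elim (between a x<a a<y a~x)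
    ... | no a≁x with suc x ≤? b | b <? y
    ...   | yes x<b | yes b<y = x<b , b<y
    ...   | no x≮b  | _       = ⊥-elim (a≁x (~-sym (b≤x⇒x~a (≤-pred (≰⇒> x≮b)))))
      where
        b≤x⇒x~a : b ≤ x → x ~ a
        b≤x⇒x~a b≤x with m≤n⇒m<n∨m≡n b≤x
        ... | inj₂ refl = ~-sym a~b
        ... | inj₁ b<x  = ~-trans (~-sym (nc b x a y b<x x<a a<y (~-sym a~b) x~y)) (~-sym a~b)
    ...   | yes _   | no b≮y  = ⊥-elim (a≁x (~-sym (y≤b⇒x~a (≮⇒≥ b≮y))))
      where
        y≤b⇒x~a : y ≤ b → x ~ a
        y≤b⇒x~a y≤b with m≤n⇒m<n∨m≡n y≤b
        ... | inj₂ refl = ~-trans x~y (~-sym a~b)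
        ... | inj₁ y<b  = nc x a y b x<a a<y y<b x~y a~b

Refines⇒~ : ∀ {n} {π σ : Partition n} → Refines π σ → ∀ {x y} → OnNat._~_ π x y → OnNat._~_ σ x y
Refines⇒~ {n} {π} {σ} π≤σ {x} {y} x~y with x <? n
... | yes x<n = subst₂ S._~_ (toℕ-fromℕ< x<n) (toℕ-fromℕ< y<n)
                  (S.~-toℕ _ _ (π≤σ _ _ (P.toℕ-~ _ _ (subst₂ P._~_ (sym (toℕ-fromℕ< x<n)) (sym (toℕ-fromℕ< y<n)) x~y))))
  where
    module P = OnNat π
    module S = OnNat σ
    y<n : y < n
    y<n = P.~-<n x<n x~y
... | no x≮n = cong (OnNat.label σ) (OnNat.~-≥n π x≮n x~y)

Refines⇒Closed : ∀ {n} {π σ : Partition n} → Refines π σ → ∀ {a b} → OnNat.Closed σ a b → OnNat.Closed π a b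
Refines⇒Closed π≤σ closed x y x~y = closed x y (Refines⇒~ π≤σ x~y)

private
  even<odd⇒≤ : ∀ {x i} → 2 * x < suc (2 * i) → x ≤ i
  even<odd⇒≤ h = *-cancelˡ-≤ 2 (≤-pred h)

  odd<even⇒< : ∀ {i x} → suc (2 * i) < 2 * x → i < x
  odd<even⇒< {i} {x} h = *-cancelˡ-≤ 2 (subst (_≤ 2 * x) (sym (*-suc 2 i)) h)

  ≤⇒even<odd : ∀ {x i} → x ≤ i → 2 * x < suc (2 * i)
  ≤⇒even<odd h = s≤s (*-monoʳ-≤ 2 h)

  <⇒odd<even : ∀ {i x} → i < x → suc (2 * i) < 2 * x
  <⇒odd<even {i} {x} h = subst (_≤ 2 * x) (*-suc 2 i) (*-monoʳ-≤ 2 h)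

-- i′ and j′ lie in one block of the Kreweras dual iff the points strictly between them,
-- i + 1, …, j, form a union of blocks.
module KrewerasOnNat {n : ℕ} (π : Partition n) where
  open OnNat π

  infix 4 _~′_
  _~′_ : ℕ → ℕ → Set
  i ~′ j = (i ≤ j → Closed (suc i) (suc j)) × (j ≤ i → Closed (suc j) (suc i))

  _~′?_ : ∀ i j → Dec (i ~′ j)
  i ~′? j = ((i ≤? j) →-dec Closed? (suc i) (suc j)) ×-dec ((j ≤? i) →-dec Closed? (suc j) (suc i))

  ~′-intro : ∀ {i j} → i ≤ j → Closed (suc i) (suc j) → i ~′ j
  ~′-intro {i} {j} i≤j closed = (λ _ → closed) , λ j≤i → subst (λ k → Closed (suc j) (suc k)) (≤-antisym j≤i i≤j) (Closed-empty (suc j))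

  ~′-sym : ∀ {i j} → i ~′ j → j ~′ i
  ~′-sym (to , from) = from , to

  ~′-refl : ∀ {i} → i ~′ i
  ~′-refl {i} = ~′-intro ≤-refl (Closed-empty (suc i))

  ~′-trans : ∀ {i j k} → i ~′ j → j ~′ k → i ~′ k
  ~′-trans {i} {j} {k} i~′j j~′k with ≤-total i j | ≤-total j k
  ... | inj₁ i≤j | inj₁ j≤k = ~′-intro (≤-trans i≤j j≤k) (Closed-∪ (s≤s i≤j) (s≤s j≤k) (proj₁ i~′j i≤j) (proj₁ j~′k j≤k))
  ... | inj₂ j≤i | inj₂ k≤j = ~′-sym (~′-intro (≤-trans k≤j j≤i) (Closed-∪ (s≤s k≤j) (s≤s j≤i) (proj₂ j~′k k≤j) (proj₂ i~′j j≤i)))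
  ... | inj₁ i≤j | inj₂ k≤j with ≤-total i k
  ...   | inj₁ i≤k = ~′-intro i≤k (Closed-∖ʳ (s≤s k≤j) (proj₁ i~′j i≤j) (proj₂ j~′k k≤j))
  ...   | inj₂ k≤i = ~′-sym (~′-intro k≤i (Closed-∖ʳ (s≤s i≤j) (proj₂ j~′k k≤j) (proj₁ i~′j i≤j)))
  ~′-trans {i} {j} {k} i~′j j~′k | inj₂ j≤i | inj₁ j≤k with ≤-total i k
  ...   | inj₁ i≤k = ~′-intro i≤k (Closed-∖ˡ (s≤s j≤i) (proj₁ j~′k j≤k) (proj₂ i~′j j≤i))
  ...   | inj₂ k≤i = ~′-sym (~′-intro k≤i (Closed-∖ˡ (s≤s j≤k) (proj₂ i~′j j≤i) (proj₁ j~′k j≤k)))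

  ~′-noncrossing : ∀ {i k j l} → i < k → k < j → j < l → i ~′ j → k ~′ l → i ~′ k
  ~′-noncrossing {i} {k} {j} {l} i<k k<j j<l i~′j k~′l = ~′-intro (<⇒≤ i<k) closed
    where
      closed : Closed (suc i) (suc k)
      closed x y x~y i<x x≤k with proj₁ i~′j (<⇒≤ (<-trans i<k k<j)) x y x~y i<x (<-trans x≤k (s≤s k<j))
      ... | i<y , y≤j with suc k ≤? y
      ...   | no k≮y  = i<y , ≰⇒> k≮y
      ...   | yes k<y = ⊥-elim (<⇒≱ x≤k (proj₁ (proj₁ k~′l (<⇒≤ (<-trans k<j j<l)) y x (~-sym x~y) k<y (<-trans y≤j (s≤s j<l)))))

  firstDualMate : ∀ x → Least (x ~′_) (suc x)
  firstDualMate x = Search.least (x ~′?_) ~′-refl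

  kreweras : Partition n
  kreweras i = Least.min (firstDualMate (toℕ i))

  kreweras-sound : ∀ i j → kreweras i ≡ kreweras j → toℕ i ~′ toℕ j
  kreweras-sound i j eq = ~′-trans (Least.P-min (firstDualMate (toℕ i)))
                            (~′-sym (subst (toℕ j ~′_) (sym eq) (Least.P-min (firstDualMate (toℕ j)))))

  kreweras-complete : ∀ i j → toℕ i ~′ toℕ j → kreweras i ≡ kreweras j
  kreweras-complete i j i~′j = ≤-antisym
    (Least.min≤ (firstDualMate (toℕ i)) (~′-trans i~′j (Least.P-min (firstDualMate (toℕ j)))))
    (Least.min≤ (firstDualMate (toℕ j)) (~′-trans (~′-sym i~′j) (Least.P-min (firstDualMate (toℕ i)))))

  module _ (nc : NoncrossingOnℕ) where

    kreweras-jointNoncrossing : JointNoncrossing π kreweras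
    kreweras-jointNoncrossing (inj₁ a) b (inj₂ c) e _ _ _ (() , _)
    kreweras-jointNoncrossing (inj₂ a) b (inj₁ c) e _ _ _ (() , _)
    kreweras-jointNoncrossing a (inj₁ b) c (inj₂ e) _ _ _ (_ , () , _)
    kreweras-jointNoncrossing a (inj₂ b) c (inj₁ e) _ _ _ (_ , () , _)
    kreweras-jointNoncrossing (inj₁ a) (inj₁ b) (inj₁ c) (inj₁ e) a<b b<c c<e (a~c , b~e , a≁b) =
      a≁b (toℕ-~ a b (nc _ _ _ _ (*-cancelˡ-< 2 _ _ a<b) (*-cancelˡ-< 2 _ _ b<c) (*-cancelˡ-< 2 _ _ c<e) (~-toℕ a c a~c) (~-toℕ b e b~e)))
    kreweras-jointNoncrossing (inj₂ a) (inj₂ b) (inj₂ c) (inj₂ e) a<b b<c c<e (a~c , b~e , a≁b) =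
      a≁b (kreweras-complete a b (~′-noncrossing (*-cancelˡ-< 2 _ _ (≤-pred a<b)) (*-cancelˡ-< 2 _ _ (≤-pred b<c)) (*-cancelˡ-< 2 _ _ (≤-pred c<e))
                                                  (kreweras-sound a c a~c) (kreweras-sound b e b~e)))
    kreweras-jointNoncrossing (inj₁ x) (inj₂ i) (inj₁ y) (inj₂ j) x<i′ i′<y y<j′ (x~y , i~j , _) =
      <⇒≱ (s≤s x≤i) (proj₁ (between-closed (toℕ y) (toℕ x) (~-sym (~-toℕ x y x~y)) i<y (s≤s y≤j)))
      where
        x≤i : toℕ x ≤ toℕ i
        x≤i = even<odd⇒≤ x<i′
        i<y : toℕ i < toℕ y
        i<y = odd<even⇒< i′<y
        y≤j : toℕ y ≤ toℕ j
        y≤j = even<odd⇒≤ y<j′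
        between-closed : Closed (suc (toℕ i)) (suc (toℕ j))
        between-closed = proj₁ (kreweras-sound i j i~j) (<⇒≤ (<-≤-trans i<y y≤j))
    kreweras-jointNoncrossing (inj₂ i) (inj₁ x) (inj₂ j) (inj₁ y) i′<x x<j′ j′<y (i~j , x~y , _) =
      <⇒≱ (proj₂ (between-closed (toℕ x) (toℕ y) (~-toℕ x y x~y) i<x (s≤s x≤j))) (odd<even⇒< j′<y)
      where
        i<x : toℕ i < toℕ x
        i<x = odd<even⇒< i′<x
        x≤j : toℕ x ≤ toℕ j
        x≤j = even<odd⇒≤ x<j′
        between-closed : Closed (suc (toℕ i)) (suc (toℕ j))
        between-closed = proj₁ (kreweras-sound i j i~j) (<⇒≤ (<-≤-trans i<x x≤j))

  module _ (ρ : Partition n) (jnc : JointNoncrossing π ρ) where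

    -- A π-block leaving the interval between i′ and j′ would cross the ρ-block of i′ and j′.
    jointNoncrossing⇒Closed : ∀ i j → ρ i ≡ ρ j → Closed (suc (toℕ i)) (suc (toℕ j))
    jointNoncrossing⇒Closed i j i~j x y x~y i<x x≤j with suc (toℕ i) ≤? y | y <? suc (toℕ j)
    ... | yes i<y | yes y≤j = i<y , y≤j
    ... | no i≮y  | _ = ⊥-elim (jnc (inj₁ (fromℕ< y<n)) (inj₂ i) (inj₁ (fromℕ< x<n)) (inj₂ j)
          (subst (λ z → 2 * z < _) (sym (toℕ-fromℕ< y<n)) (≤⇒even<odd (≤-pred (≰⇒> i≮y))))
          (subst (λ z → _ < 2 * z) (sym (toℕ-fromℕ< x<n)) (<⇒odd<even i<x))
          (subst (λ z → 2 * z < _) (sym (toℕ-fromℕ< x<n)) (≤⇒even<odd (≤-pred x≤j)))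
          (toℕ-~ _ _ (subst₂ _~_ (sym (toℕ-fromℕ< y<n)) (sym (toℕ-fromℕ< x<n)) (~-sym x~y)) , i~j , λ ()))
      where
        x<n : x < n
        x<n = ~-≢⇒<n x~y λ x≡y → i≮y (subst (suc (toℕ i) ≤_) x≡y i<x)
        y<n : y < n
        y<n = ~-<n x<n x~y
    ... | yes _ | no y≰j = ⊥-elim (jnc (inj₂ i) (inj₁ (fromℕ< x<n)) (inj₂ j) (inj₁ (fromℕ< y<n))
          (subst (λ z → _ < 2 * z) (sym (toℕ-fromℕ< x<n)) (<⇒odd<even i<x))
          (subst (λ z → 2 * z < _) (sym (toℕ-fromℕ< x<n)) (≤⇒even<odd (≤-pred x≤j)))
          (subst (λ z → _ < 2 * z) (sym (toℕ-fromℕ< y<n)) (<⇒odd<even (≤-pred (≰⇒> y≰j))))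
          (i~j , toℕ-~ _ _ (subst₂ _~_ (sym (toℕ-fromℕ< x<n)) (sym (toℕ-fromℕ< y<n)) x~y) , λ ()))
      where
        x<n : x < n
        x<n = ~-≢⇒<n x~y λ x≡y → y≰j (subst (_< suc (toℕ j)) x≡y x≤j)
        y<n : y < n
        y<n = ~-<n x<n x~y

    jointNoncrossing⇒~′ : ∀ i j → ρ i ≡ ρ j → toℕ i ~′ toℕ j
    jointNoncrossing⇒~′ i j i~j with ≤-total (toℕ i) (toℕ j)
    ... | inj₁ i≤j = ~′-intro i≤j (jointNoncrossing⇒Closed i j i~j)
    ... | inj₂ j≤i = ~′-sym (~′-intro j≤i (jointNoncrossing⇒Closed j i (sym i~j)))

  kreweras-isDual : NoncrossingOnℕ → IsKrewerasDual π kreweras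
  kreweras-isDual nc = kreweras-jointNoncrossing nc , λ ρ jnc i j i~j → kreweras-complete i j (jointNoncrossing⇒~′ ρ jnc i j i~j)

  isKrewerasDual⇒~′ : NoncrossingOnℕ → ∀ {ρ} → IsKrewerasDual π ρ → ∀ i j → ρ i ≡ ρ j ⇔ toℕ i ~′ toℕ j
  isKrewerasDual⇒~′ nc {ρ} (jnc , coarsest) i j =
    mk⇔ (jointNoncrossing⇒~′ ρ jnc i j) λ i~′j → coarsest kreweras (kreweras-jointNoncrossing nc) i j (kreweras-complete i j i~′j)

module ModularBlocks (d : ℕ) {n : ℕ} (π : Partition n) where
  open OnNat π
  open KrewerasOnNat π

  module BlockCount (x : ℕ) = Count (_~? x)
  module PrefixCount (a : ℕ) = Count (λ j → Closed? a (suc j))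
  module DualCount (k : ℕ) = Count (k ~′?_)

  closedPrefixes : ℕ → ℕ → ℕ
  closedPrefixes a b = PrefixCount.count a a b

  BlocksOneMod : Set
  BlocksOneMod = ∀ x → x < n → BlockCount.count x 0 n ≡ 1 mod d

  DualBlocksOneMod : Set
  DualBlocksOneMod = ∀ k → k < n → DualCount.count k 0 n ≡ 1 mod d

  -- For consecutive elements x < y of a block this says y ≡ x + 1.
  Aligned : ℕ → ℕ → Set
  Aligned x y = y ≡ x + BlockCount.count x (suc x) (suc y) mod d

  AlignedIn : ℕ → ℕ → Set
  AlignedIn a b = ∀ x y → a ≤ x → x < y → y < b → x ~ y → Aligned x y

  BlocksAligned : Set
  BlocksAligned = ∀ x y → x < y → x ~ y → Aligned x y

  BlocksAligned⇒AlignedIn : BlocksAligned → ∀ {a b} → AlignedIn a b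
  BlocksAligned⇒AlignedIn aligned x y _ x<y _ = aligned x y x<y

  Consecutive : ℕ → ℕ → Set
  Consecutive x y = x < y × x ~ y × (∀ z → x < z → z < y → ¬ z ~ x)

  consecutive-count : ∀ {x y} → Consecutive x y → BlockCount.count x (suc x) (suc y) ≡ 1
  consecutive-count {x} {y} (x<y , x~y , between) =
    BlockCount.count-unique x x<y ≤-refl (~-sym x~y) λ z x<z z≤y z≢y → between z x<z (≤∧≢⇒< (≤-pred z≤y) z≢y)

  consecutive⇒Aligned : ∀ {x y} → Consecutive x y → y ≡ suc x mod d → Aligned x y
  consecutive⇒Aligned {x} {y} con y≡1+x =
    ≡-mod-trans y≡1+x (≡⇒≡-mod (trans (+-comm 1 x) (cong (x +_) (sym (consecutive-count con)))))

  Aligned⇒consecutive : ∀ {x y} → Consecutive x y → Aligned x y → y ≡ suc x mod d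
  Aligned⇒consecutive {x} {y} con aligned =
    ≡-mod-trans aligned (≡⇒≡-mod (trans (cong (x +_) (consecutive-count con)) (+-comm x 1)))

  Aligned-trans : ∀ {x z y} → x < z → z < y → z ~ x → Aligned x z → Aligned z y → Aligned x y
  Aligned-trans {x} {z} {y} x<z z<y z~x xz zy =
    ≡-mod-trans zy (≡-mod-trans (+-cong-mod xz (≡⇒≡-mod same-block)) (≡⇒≡-mod (begin
      (x + BlockCount.count x (suc x) (suc z)) + BlockCount.count x (suc z) (suc y) ≡⟨ +-assoc x _ _ ⟩
      x + (BlockCount.count x (suc x) (suc z) + BlockCount.count x (suc z) (suc y)) ≡⟨ cong (x +_) (BlockCount.count-split x (s≤s (<⇒≤ x<z)) (s≤s (<⇒≤ z<y))) ⟨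
      x + BlockCount.count x (suc x) (suc y) ∎)))
    where
      open ≡-Reasoning
      same-block : BlockCount.count z (suc z) (suc y) ≡ BlockCount.count x (suc z) (suc y)
      same-block = count-cong (_~? z) (_~? x) (suc z) (suc y) λ w _ _ → mk⇔ (λ w~z → ~-trans w~z z~x) (λ w~x → ~-trans w~x (~-sym z~x))

  -- Induction on y − x, splitting at the first block-mate of x in between.
  alignment-induction : (∀ {x y} → Consecutive x y → AlignedIn (suc x) y → y ≡ suc x mod d) → BlocksAligned
  alignment-induction step x₀ y₀ = bounded y₀ x₀ y₀ (m≤n+m y₀ x₀)
    where
      bounded : ∀ bound x y → y ≤ x + bound → x < y → x ~ y → Aligned x y
      bounded zero x y y≤x+0 x<y _ = contradiction (subst (y ≤_) (+-identityʳ x) y≤x+0) (<⇒≱ x<y)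
      bounded (suc bound) x y y≤x+1+bound x<y x~y with Search.least< (λ z → (x <? z) ×-dec (z ~? x)) y
      ... | inj₂ l = Aligned-trans x<z z<y z~x (bounded bound x z z≤x+bound x<z (~-sym z~x)) (bounded bound z y y≤z+bound z<y (~-trans z~x x~y))
        where
          open Least l renaming (min to z; min< to z<y)
          x<z : x < z
          x<z = proj₁ P-min
          z~x : z ~ x
          z~x = proj₂ P-min
          z≤x+bound : z ≤ x + bound
          z≤x+bound = ≤-pred (≤-trans z<y (subst (y ≤_) (+-suc x bound) y≤x+1+bound))
          y≤z+bound : y ≤ z + bound
          y≤z+bound = ≤-trans y≤x+1+bound (subst (_≤ z + bound) (sym (+-suc x bound)) (+-monoˡ-≤ bound x<z))
      ... | inj₁ none = consecutive⇒Aligned con (step con λ a b x<a a<b b<y a~b → bounded bound a b (b≤a+bound b<y x<a) a<b a~b)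
        where
          con : Consecutive x y
          con = x<y , x~y , λ z x<z z<y z~x → none z z<y (x<z , z~x)
          b≤a+bound : ∀ {a b} → b < y → suc x ≤ a → b ≤ a + bound
          b≤a+bound b<y x<a = ≤-trans (≤-pred (≤-trans b<y (subst (y ≤_) (+-suc x bound) y≤x+1+bound))) (+-monoˡ-≤ bound (<⇒≤ x<a))

  module _ (nc : NoncrossingOnℕ) (ones : BlocksOneMod) where

    record BlockHull (u : ℕ) : Set where
      field
        last    : ℕ
        u≤last  : u ≤ last
        last<n  : last < n
        last~u  : last ~ u
        ≤last   : ∀ z → z ~ u → z ≤ last
        closed  : Closed u (suc last)
        count≡0 : BlockCount.count u (suc u) (suc last) ≡ 0 mod d

      last≡u : (u < last → Aligned u last) → last ≡ u mod d
      last≡u aligned with m≤n⇒m<n∨m≡n u≤last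
      ... | inj₂ u≡last = ≡⇒≡-mod (sym u≡last)
      ... | inj₁ u<last = begin
        last                                     ≈⟨ aligned u<last ⟩
        u + BlockCount.count u (suc u) (suc last) ≈⟨ +-cong-mod (≡-mod-refl {a = u}) count≡0 ⟩
        u + 0                                    ≡⟨ +-identityʳ u ⟩
        u                                        ∎
        where open ≡-mod-Reasoning

    blockHull : ∀ {u} → u < n → NoneBelow (_~ u) u → BlockHull u
    blockHull {u} u<n u-least with Search.greatest< (_~? u) n
    ... | inj₁ none = contradiction refl (none u u<n)
    ... | inj₂ g = record
      { last = max ; u≤last = u≤max ; last<n = max< ; last~u = P-max ; ≤last = ≤max'
      ; closed = Closed-hull nc P-max λ z z~u → u≤ z~u , ≤max' z z~u ; count≡0 = count≡0 }
      where
        open Greatest g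
        module C = BlockCount u
        u≤ : ∀ {z} → z ~ u → u ≤ z
        u≤ {z} z~u = ≮⇒≥ λ z<u → u-least z z<u z~u
        ≤max' : ∀ z → z ~ u → z ≤ max
        ≤max' z z~u = ≤max (~-<n u<n (~-sym z~u)) z~u
        u≤max : u ≤ max
        u≤max = ≤max' u refl
        count≡0 : C.count (suc u) (suc max) ≡ 0 mod d
        count≡0 = +-cancelˡ-mod 1 (≡-mod-trans (≡⇒≡-mod (sym split)) (ones u u<n))
          where
            open ≡-Reasoning
            split : C.count 0 n ≡ 1 + C.count (suc u) (suc max)
            split = begin
              C.count 0 n                                          ≡⟨ C.count-splitAt z≤n u<n ⟩
              C.count 0 u + (C.indicator u + C.count (suc u) n)    ≡⟨ cong₂ (λ a c → a + (c + C.count (suc u) n))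
                                                                       (C.count-none 0 u λ z _ z<u → u-least z z<u) (C.indicator-yes refl) ⟩
              1 + C.count (suc u) n                                ≡⟨ cong suc (C.count-split (s≤s u≤max) max<) ⟩
              1 + (C.count (suc u) (suc max) + C.count (suc max) n) ≡⟨ cong (λ a → 1 + (C.count (suc u) (suc max) + a))
                                                                       (C.count-none (suc max) n λ z max<z _ z~u → <⇒≱ max<z (≤max' z z~u)) ⟩
              1 + (C.count (suc u) (suc max) + 0)                  ≡⟨ cong suc (+-identityʳ _) ⟩
              1 + C.count (suc u) (suc max)                        ∎

    module _ {a b : ℕ} (a<b : a < b) (b≤n : b ≤ n) (closed : Closed a b) where

      hullIn : BlockHull a
      hullIn = blockHull (<-≤-trans a<b b≤n) λ z z<a z~a → <⇒≱ z<a (proj₁ (closed a z (~-sym z~a) ≤-refl a<b))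

      open BlockHull hullIn using (last; u≤last; last~u) renaming (closed to hull-closed)

      last<b : last < b
      last<b = proj₂ (closed a last (~-sym last~u) ≤-refl a<b)

      closedPrefixes-split : closedPrefixes a b ≡ 1 + closedPrefixes (suc last) b
      closedPrefixes-split = begin
        C.count a b                                      ≡⟨ C.count-splitAt u≤last last<b ⟩
        C.count a last + (C.indicator last + C.count (suc last) b) ≡⟨ cong₂ (λ u v → u + (v + C.count (suc last) b)) inside (C.indicator-yes hull-closed) ⟩
        1 + C.count (suc last) b                         ≡⟨ cong suc rest ⟩
        1 + closedPrefixes (suc last) b                  ∎
        where
          open ≡-Reasoning
          module C = PrefixCount a
          inside : C.count a last ≡ 0
          inside = C.count-none a last λ j a≤j j<last closed' → <⇒≱ j<last (≤-pred (proj₂ (closed' a last (~-sym last~u) ≤-refl (s≤s a≤j))))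
          rest : C.count (suc last) b ≡ closedPrefixes (suc last) b
          rest = count-cong (λ j → Closed? a (suc j)) (λ j → Closed? (suc last) (suc j)) (suc last) b λ j last<j _ →
            mk⇔ (λ closed' → Closed-∖ˡ (≤-trans u≤last (n≤1+n last)) closed' hull-closed)
                (Closed-∪ (≤-trans u≤last (n≤1+n last)) (≤-trans last<j (n≤1+n j)) hull-closed)

      Closed-rest : Closed (suc last) b
      Closed-rest = Closed-∖ˡ (≤-trans u≤last (n≤1+n last)) closed hull-closed

    -- Each closed prefix peels off the hull of one block, whose length is ≡ 1.
    closed-length : ∀ bound a b → b ≤ a + bound → a ≤ b → b ≤ n → Closed a b → AlignedIn a b →
                    b ≡ a + closedPrefixes a b mod d
    closed-length bound a b b≤a+bound a≤b b≤n closed aligned with m≤n⇒m<n∨m≡n a≤b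
    ... | inj₂ refl = ≡⇒≡-mod (sym (trans (cong (a +_) (PrefixCount.count-empty a a)) (+-identityʳ a)))
    closed-length zero a b b≤a+0 a≤b b≤n closed aligned | inj₁ a<b = contradiction (subst (b ≤_) (+-identityʳ a) b≤a+0) (<⇒≱ a<b)
    closed-length (suc bound) a b b≤a+bound a≤b b≤n closed aligned | inj₁ a<b = begin
      b                                      ≈⟨ ih ⟩
      suc last + closedPrefixes (suc last) b ≈⟨ +-cong-mod (+-cong-mod (≡-mod-refl {a = 1}) last≡a) ≡-mod-refl ⟩
      (1 + a) + closedPrefixes (suc last) b  ≡⟨ cong (_+ closedPrefixes (suc last) b) (+-comm 1 a) ⟩
      (a + 1) + closedPrefixes (suc last) b  ≡⟨ +-assoc a 1 _ ⟩
      a + (1 + closedPrefixes (suc last) b)  ≡⟨ cong (a +_) (closedPrefixes-split a<b b≤n closed) ⟨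
      a + closedPrefixes a b                 ∎
      where
        open ≡-mod-Reasoning
        open BlockHull (hullIn a<b b≤n closed) using (last; u≤last; last~u; last≡u)
        last≡a : last ≡ a mod d
        last≡a = last≡u λ a<last → aligned a last ≤-refl a<last (last<b a<b b≤n closed) (~-sym last~u)
        ih : b ≡ suc last + closedPrefixes (suc last) b mod d
        ih = closed-length bound (suc last) b (≤-trans b≤a+bound (subst (_≤ suc last + bound) (sym (+-suc a bound)) (+-monoˡ-≤ bound (s≤s u≤last))))
               (last<b a<b b≤n closed) b≤n (Closed-rest a<b b≤n closed) λ x y last<x → aligned x y (≤-trans u≤last (<⇒≤ last<x))

    -- The points between j′ and (n − 1)′ form [j + 1, n), the complement of [0, j + 1).
    dualCount-last : ∀ m → n ≡ suc m → DualCount.count m 0 n ≡ closedPrefixes 0 n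
    dualCount-last m refl = count-cong (m ~′?_) (λ j → Closed? 0 (suc j)) 0 (suc m) λ j _ j<n → mk⇔
      (λ m~′j → Closed-∖ʳ j<n Closed-all (proj₂ m~′j (≤-pred j<n)))
      (λ prefix → ~′-sym (~′-intro (≤-pred j<n) (Closed-∖ˡ z≤n Closed-all prefix)))

    n≡1 : BlocksAligned → DualBlocksOneMod → 0 < n → n ≡ 1 mod d
    n≡1 aligned dualOnes 0<n = begin
      n                      ≈⟨ closed-length n 0 n ≤-refl z≤n ≤-refl Closed-all (BlocksAligned⇒AlignedIn aligned) ⟩
      closedPrefixes 0 n     ≡⟨ dualCount-last m n≡1+m ⟨
      DualCount.count m 0 n  ≈⟨ dualOnes m (subst (m <_) (sym n≡1+m) ≤-refl) ⟩
      1                      ∎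
      where
        open ≡-mod-Reasoning
        m : ℕ
        m = n ∸ 1
        n≡1+m : n ≡ suc m
        n≡1+m = sym (m+[n∸m]≡n 0<n)

    dualCount-consecutive : ∀ {x y} → Consecutive x y → y < n → DualCount.count x 0 n ≡ 1 + closedPrefixes (suc x) y
    dualCount-consecutive {x} {y} con@(x<y , x~y , _) y<n = begin
      C.count 0 n                                        ≡⟨ C.count-splitAt z≤n (<-trans x<y y<n) ⟩
      C.count 0 x + (C.indicator x + C.count (suc x) n)  ≡⟨ cong₂ (λ u v → u + (v + C.count (suc x) n)) before (C.indicator-yes ~′-refl) ⟩
      1 + C.count (suc x) n                              ≡⟨ cong suc (C.count-split x<y (<⇒≤ y<n)) ⟩
      1 + (C.count (suc x) y + C.count y n)              ≡⟨ cong₂ (λ u v → 1 + (u + v)) between after ⟩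
      1 + (closedPrefixes (suc x) y + 0)                 ≡⟨ cong suc (+-identityʳ _) ⟩
      1 + closedPrefixes (suc x) y                       ∎
      where
        open ≡-Reasoning
        module C = DualCount x
        before : C.count 0 x ≡ 0
        before = C.count-none 0 x λ j _ j<x x~′j →
          <⇒≱ x<y (≤-pred (proj₂ (proj₂ x~′j (<⇒≤ j<x) x y x~y j<x ≤-refl)))
        after : C.count y n ≡ 0
        after = C.count-none y n λ j y≤j _ x~′j →
          <-irrefl refl (proj₁ (proj₁ x~′j (<⇒≤ (<-≤-trans x<y y≤j)) y x (~-sym x~y) x<y (s≤s y≤j)))
        between : C.count (suc x) y ≡ closedPrefixes (suc x) y
        between = count-cong (x ~′?_) (λ j → Closed? (suc x) (suc j)) (suc x) y λ j x<j _ →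
          mk⇔ (λ x~′j → proj₁ x~′j (<⇒≤ x<j)) (~′-intro (<⇒≤ x<j))

    -- The gap between consecutive x < y is closed, so its length is the number of its closed
    -- prefixes, which is the size of the dual block of x′ minus one.
    consecutive-aligned : DualBlocksOneMod → ∀ {x y} → Consecutive x y → AlignedIn (suc x) y → y ≡ suc x mod d
    consecutive-aligned dualOnes {x} {y} con@(x<y , x~y , between) inner = begin
      y                                ≈⟨ closed-length y (suc x) y (m≤n+m y (suc x)) x<y (<⇒≤ y<n) (Closed-gap nc x<y x~y between) inner ⟩
      suc x + closedPrefixes (suc x) y ≈⟨ +-cong-mod (≡-mod-refl {a = suc x}) no-prefixes ⟩
      suc x + 0                        ≡⟨ +-identityʳ (suc x) ⟩
      suc x                            ∎
      where
        open ≡-mod-Reasoning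
        y<n : y < n
        y<n = ~-<n (~-≢⇒<n x~y (<⇒≢ x<y)) x~y
        no-prefixes : closedPrefixes (suc x) y ≡ 0 mod d
        no-prefixes = +-cancelˡ-mod 1 (≡-mod-trans (≡⇒≡-mod (sym (dualCount-consecutive con y<n))) (dualOnes x (<-trans x<y y<n)))

    blocksAligned : DualBlocksOneMod → BlocksAligned
    blocksAligned dualOnes = alignment-induction (consecutive-aligned dualOnes)

    dualCount-cong : ∀ {k k′} → k ~′ k′ → ∀ a b → DualCount.count k a b ≡ DualCount.count k′ a b
    dualCount-cong k~′k′ a b = count-cong (_ ~′?_) (_ ~′?_) a b λ j _ _ →
      mk⇔ (~′-trans (~′-sym k~′k′)) (~′-trans k~′k′)

    module _ (aligned : BlocksAligned) (n≡1 : n ≡ 1 mod d) where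

      -- If j0′ and j1′ are the least and greatest points of the dual block of k′, and j1 + 1 < n,
      -- then j0 and j1 + 1 are consecutive elements of one block of π.
      module DualBlockEnds {k : ℕ} (k<n : k < n) (greatest : Greatest (k ~′_) n) (w<n : suc (Greatest.max greatest) < n) where
        open Greatest greatest using () renaming (max to j1; P-max to k~′j1; ≤max to ≤j1)
        open Least (firstDualMate k) using () renaming (min to j0; P-min to k~′j0; min≤ to j0≤)

        w : ℕ
        w = suc j1

        j0≤j1 : j0 ≤ j1
        j0≤j1 = ≤-trans (j0≤ ~′-refl) (≤j1 k<n ~′-refl)

        gap : Closed (suc j0) w
        gap = proj₁ (~′-trans (~′-sym k~′j0) k~′j1) j0≤j1

        no-mate-in-gap : ∀ z → j0 < z → z < w → ¬ z ~ w
        no-mate-in-gap z j0<z z<w z~w = <-irrefl refl (proj₂ (gap z w z~w j0<z z<w))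

        -- Otherwise w is the least element of its block, and the dual block would reach past its hull.
        some-mate-≤j0 : Greatest (_~ w) (suc j0)
        some-mate-≤j0 with Search.greatest< (_~? w) (suc j0)
        ... | inj₂ mate = mate
        ... | inj₁ none = ⊥-elim (<⇒≱ (BlockHull.u≤last hull) (≤j1 (BlockHull.last<n hull) k~′last))
          where
            w-least : NoneBelow (_~ w) w
            w-least z z<w z~w with z ≤? j0
            ... | yes z≤j0 = none z (s≤s z≤j0) z~w
            ... | no z≰j0  = no-mate-in-gap z (≰⇒> z≰j0) z<w z~w
            hull : BlockHull w
            hull = blockHull w<n w-least
            k~′last : k ~′ BlockHull.last hull
            k~′last = ~′-trans k~′j0 (~′-intro (≤-trans j0≤j1 (≤-trans (n≤1+n j1) (BlockHull.u≤last hull)))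
                        (Closed-∪ (s≤s j0≤j1) (≤-trans (BlockHull.u≤last hull) (n≤1+n _)) gap (BlockHull.closed hull)))

        consecutive : Consecutive j0 w
        consecutive = subst (λ l → Consecutive l w) l≡j0 l-consecutive
          where
            open Greatest some-mate-≤j0 using () renaming (max to l; P-max to l~w; max< to l≤j0; above-max to above-l)
            l-consecutive : Consecutive l w
            l-consecutive = s≤s (≤-trans (≤-pred l≤j0) j0≤j1) , l~w , λ z l<z z<w z~l → case z ≤? j0 of λ where
              (yes z≤j0) → above-l z l<z (s≤s z≤j0) (~-trans z~l l~w)
              (no z≰j0)  → no-mate-in-gap z (≰⇒> z≰j0) z<w (~-trans z~l l~w)
            k~′l : k ~′ l
            k~′l = ~′-trans k~′j1 (~′-sym (~′-intro (≤-trans (≤-pred l≤j0) j0≤j1)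
                     (Closed-gap nc (proj₁ l-consecutive) l~w (proj₂ (proj₂ l-consecutive)))))
            l≡j0 : l ≡ j0
            l≡j0 = ≤-antisym (≤-pred l≤j0) (j0≤ k~′l)

        -- The dual block of k′ is that of j0′, which has one point besides j0′ per closed prefix of
        -- the gap between j0 and w; their number is ≡ w − (j0 + 1) ≡ 0.
        dualCount≡1 : DualCount.count k 0 n ≡ 1 mod d
        dualCount≡1 = begin
          DualCount.count k 0 n           ≡⟨ dualCount-cong k~′j0 0 n ⟩
          DualCount.count j0 0 n          ≡⟨ dualCount-consecutive consecutive w<n ⟩
          1 + closedPrefixes (suc j0) w   ≈⟨ +-cong-mod (≡-mod-refl {a = 1}) no-prefixes ⟩
          1                               ∎
          where
            open ≡-mod-Reasoning
            w≡1+j0 : w ≡ suc j0 mod d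
            w≡1+j0 = Aligned⇒consecutive consecutive (aligned j0 w (s≤s j0≤j1) (proj₁ (proj₂ consecutive)))
            gap-length : w ≡ suc j0 + closedPrefixes (suc j0) w mod d
            gap-length = closed-length w (suc j0) w (m≤n+m w (suc j0)) (s≤s j0≤j1) (<⇒≤ w<n) gap (BlocksAligned⇒AlignedIn aligned)
            no-prefixes : closedPrefixes (suc j0) w ≡ 0 mod d
            no-prefixes = +-cancelˡ-mod (suc j0) (≡-mod-trans (≡-mod-sym gap-length) (≡-mod-trans w≡1+j0 (≡⇒≡-mod (sym (+-identityʳ (suc j0))))))

      dualBlocksOneMod : DualBlocksOneMod
      dualBlocksOneMod k k<n with Search.greatest< (k ~′?_) n
      ... | inj₁ none = contradiction ~′-refl (none k k<n)
      ... | inj₂ greatest with suc (Greatest.max greatest) <? n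
      ...   | yes w<n = DualBlockEnds.dualCount≡1 k<n greatest w<n
      ...   | no w≮n  = begin
        DualCount.count k 0 n  ≡⟨ dualCount-cong (Greatest.P-max greatest) 0 n ⟩
        DualCount.count j1 0 n ≡⟨ dualCount-last j1 n≡1+j1 ⟩
        closedPrefixes 0 n     ≈⟨ closed-length n 0 n ≤-refl z≤n ≤-refl Closed-all (BlocksAligned⇒AlignedIn aligned) ⟨
        n                      ≈⟨ n≡1 ⟩
        1                      ∎
        where
          open ≡-mod-Reasoning
          j1 : ℕ
          j1 = Greatest.max greatest
          n≡1+j1 : n ≡ suc j1
          n≡1+j1 = ≤-antisym (≮⇒≥ w≮n) (Greatest.max< greatest)

  blockSize≡count : ∀ i → blockSize π i ≡ BlockCount.count (toℕ i) 0 n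
  blockSize≡count i = length-filter-allFin (λ j → π j ≟ π i) (_~? toℕ i) λ j → mk⇔ (~-toℕ j i) (toℕ-~ j i)

  dualBlockSize≡count : NoncrossingOnℕ → ∀ {ρ} → IsKrewerasDual π ρ → ∀ i → blockSize ρ i ≡ DualCount.count (toℕ i) 0 n
  dualBlockSize≡count nc isDual i = length-filter-allFin (λ j → _ ≟ _) (toℕ i ~′?_) λ j →
    mk⇔ (~′-sym ∘ Equivalence.to (isKrewerasDual⇒~′ nc isDual j i)) (Equivalence.from (isKrewerasDual⇒~′ nc isDual j i) ∘ ~′-sym)

  private
    count-pos : ∀ {P : ℕ → Set} (P? : Decidable P) {x} → x < n → P x → 0 < Count.count P? 0 n
    count-pos P? {x} x<n px = subst (0 <_) (sym (count-splitAt z≤n x<n)) (begin-strict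
      0                                    <⟨ z<s ⟩
      1                                    ≡⟨ indicator-yes px ⟨
      indicator x                          ≤⟨ m≤m+n (indicator x) _ ⟩
      indicator x + count (suc x) n        ≤⟨ m≤n+m _ (count 0 x) ⟩
      count 0 x + (indicator x + count (suc x) n) ∎)
      where
        open Count P?
        open ≤-Reasoning

  record NCdProperties : Set where
    field
      noncrossing   : NoncrossingOnℕ
      blocksOne     : BlocksOneMod
      dualBlocksOne : DualBlocksOneMod

    aligned : BlocksAligned
    aligned = blocksAligned noncrossing blocksOne dualBlocksOne

    hull : ∀ {u} → u < n → NoneBelow (_~ u) u → BlockHull noncrossing blocksOne u
    hull = blockHull noncrossing blocksOne

    hull-last≡ : ∀ {u} (h : BlockHull noncrossing blocksOne u) → BlockHull.last h ≡ u mod d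
    hull-last≡ {u} h = BlockHull.last≡u h λ u<last → aligned u _ u<last (~-sym (BlockHull.last~u h))

    consecutive-gap : ∀ {x y} → Consecutive x y → Closed (suc x) y × y ≡ suc x mod d
    consecutive-gap con@(x<y , x~y , between) = Closed-gap noncrossing x<y x~y between , Aligned⇒consecutive con (aligned _ _ x<y x~y)

  NCd⇒properties : NCd d n π → NCdProperties
  NCd⇒properties (nc , sizes , ρ , isDual , dualSizes) = record
    { noncrossing   = nc′
    ; blocksOne     = λ x x<n → subst (_≡ 1 mod d) (trans (blockSize≡count (fromℕ< x<n)) (cong (λ z → BlockCount.count z 0 n) (toℕ-fromℕ< x<n)))
                                 (1+q*d⇒≡1-mod (sizes (fromℕ< x<n)))
    ; dualBlocksOne = λ k k<n → subst (_≡ 1 mod d) (trans (dualBlockSize≡count nc′ isDual (fromℕ< k<n)) (cong (λ z → DualCount.count z 0 n) (toℕ-fromℕ< k<n)))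
                                 (1+q*d⇒≡1-mod (dualSizes (fromℕ< k<n)))
    }
    where
      nc′ : NoncrossingOnℕ
      nc′ = noncrossing⇒onℕ nc

  properties⇒NCd : (nc : NoncrossingOnℕ) (ones : BlocksOneMod) → BlocksAligned → n ≡ 1 mod d → NCd d n π
  properties⇒NCd nc ones aligned n≡1 = onℕ⇒noncrossing nc , sizes , kreweras , kreweras-isDual nc , dualSizes
    where
      sizes : BlocksOneModD d π
      sizes i = ≡1-mod⇒1+q*d (subst (0 <_) (sym (blockSize≡count i)) (count-pos (_~? toℕ i) (toℕ<n i) refl))
                              (subst (_≡ 1 mod d) (sym (blockSize≡count i)) (ones (toℕ i) (toℕ<n i)))
      dualSizes : BlocksOneModD d kreweras
      dualSizes i = ≡1-mod⇒1+q*d (subst (0 <_) (sym (dualBlockSize≡count nc (kreweras-isDual nc) i)) (count-pos (toℕ i ~′?_) (toℕ<n i) ~′-refl))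
                                  (subst (_≡ 1 mod d) (sym (dualBlockSize≡count nc (kreweras-isDual nc) i)) (dualBlocksOneMod nc ones aligned n≡1 (toℕ i) (toℕ<n i)))

module Members (d : ℕ) {n : ℕ} (π : Partition n) where
  open OnNat π
  open ModularBlocks d π

  Member : ∀ {m} → (Fin m → ℕ) → ℕ → Set
  Member b z = ∃ λ s → z ~ b s

  Member? : ∀ {m} (b : Fin m → ℕ) → Decidable (Member b)
  Member? b z = any? λ s → z ~? b s

  Distinct : ∀ {m} → (Fin m → ℕ) → Set
  Distinct b = ∀ s s′ → b s ~ b s′ → s ≡ s′

  Mergeable : ∀ {m} → (Fin m → ℕ) → Set
  Mergeable b = ∀ x y → x < y → Member b x → Member b y → (∀ z → x < z → z < y → ¬ Member b z) →
                Closed (suc x) y × y ≡ suc x mod d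

  memberCount : BlocksOneMod → ∀ m (b : Fin m → ℕ) → (∀ s → b s < n) → Distinct b → Count.count (Member? b) 0 n ≡ m mod d
  memberCount ones zero b b<n distinct = ≡⇒≡-mod (Count.count-none (Member? b) 0 n λ _ _ _ ())
  memberCount ones (suc m) b b<n distinct = ≡-mod-trans
    (≡⇒≡-mod (count-⊎ (_~? b fz) (Member? (b ∘ fs)) (Member? b) split disjoint 0 n))
    (+-cong-mod {b = 1} (ones (b fz) (b<n fz)) (memberCount ones m (b ∘ fs) (b<n ∘ fs) λ s s′ eq → fs-injective (distinct (fs s) (fs s′) eq)))
    where
      split : ∀ x → Member b x ⇔ (x ~ b fz ⊎ Member (b ∘ fs) x)
      split x = mk⇔ (λ { (fz , x~) → inj₁ x~ ; (fs s , x~) → inj₂ (s , x~) }) (λ { (inj₁ x~) → fz , x~ ; (inj₂ (s , x~)) → fs s , x~ })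
      disjoint : ∀ x → x ~ b fz → ¬ Member (b ∘ fs) x
      disjoint x x~b0 (s , x~bs) with distinct fz (fs s) (~-trans (~-sym x~b0) x~bs)
      ... | ()

module Merge (d : ℕ) {n : ℕ} (π : Partition n) {k : ℕ} (b : Fin (suc k) → ℕ) (b<n : ∀ s → b s < n) where
  open OnNat π
  open Members d π

  Member<n : ∀ {x} → Member b x → x < n
  Member<n (s , x~bs) = ~-<n (b<n s) (~-sym x~bs)

  Member-~ : ∀ {x y} → Member b x → x ~ y → Member b y
  Member-~ (s , x~bs) x~y = s , ~-trans (~-sym x~y) x~bs

  opaque
    merged : Partition n
    merged i with Member? b (toℕ i)
    ... | yes _ = π (fromℕ< (b<n fz))
    ... | no _  = π i

    merged-member : ∀ i → Member b (toℕ i) → merged i ≡ π (fromℕ< (b<n fz))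
    merged-member i member with Member? b (toℕ i)
    ... | yes _        = refl
    ... | no ¬member   = contradiction member ¬member

    merged-nonmember : ∀ i → ¬ Member b (toℕ i) → merged i ≡ π i
    merged-nonmember i ¬member with Member? b (toℕ i)
    ... | yes member = contradiction member ¬member
    ... | no _       = refl

  module M = OnNat merged

  private
    label-member : ∀ {x} → Member b x → M.label x ≡ label (b fz)
    label-member {x} member = begin
      M.label x                       ≡⟨ M.label-< x<n ⟩
      2 * merged (fromℕ< x<n)         ≡⟨ cong (2 *_) (merged-member _ (subst (Member b) (sym (toℕ-fromℕ< x<n)) member)) ⟩
      2 * π (fromℕ< (b<n fz))         ≡⟨ label-< (b<n fz) ⟨
      label (b fz)                    ∎
      where
        open ≡-Reasoning
        x<n : x < n
        x<n = Member<n member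

    label-nonmember : ∀ {x} → ¬ Member b x → M.label x ≡ label x
    label-nonmember {x} ¬member with x <? n
    ... | yes x<n = begin
      M.label x               ≡⟨ M.label-< x<n ⟩
      2 * merged (fromℕ< x<n) ≡⟨ cong (2 *_) (merged-nonmember _ (¬member ∘ subst (Member b) (toℕ-fromℕ< x<n))) ⟩
      2 * π (fromℕ< x<n)      ≡⟨ label-< x<n ⟨
      label x                 ∎
      where open ≡-Reasoning
    ... | no x≮n = trans (M.label-≥ x≮n) (sym (label-≥ x≮n))

  merged-~ : ∀ {x y} → x M.~ y ⇔ (x ~ y ⊎ Member b x × Member b y)
  merged-~ {x} {y} = mk⇔ to from
    where
      to : x M.~ y → x ~ y ⊎ Member b x × Member b y
      to x~y with Member? b x | Member? b y
      ... | yes mx   | yes my  = inj₂ (mx , my)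
      ... | no ¬mx   | no ¬my  = inj₁ (trans (sym (label-nonmember ¬mx)) (trans x~y (label-nonmember ¬my)))
      ... | yes mx   | no ¬my  = contradiction (fz , trans (sym (label-nonmember ¬my)) (trans (sym x~y) (label-member mx))) ¬my
      ... | no ¬mx   | yes my  = contradiction (fz , trans (sym (label-nonmember ¬mx)) (trans x~y (label-member my))) ¬mx
      from : x ~ y ⊎ Member b x × Member b y → x M.~ y
      from (inj₂ (mx , my)) = trans (label-member mx) (sym (label-member my))
      from (inj₁ x~y) with Member? b x
      ... | yes mx  = trans (label-member mx) (sym (label-member (Member-~ mx x~y)))
      ... | no ¬mx  = trans (label-nonmember ¬mx) (trans x~y (sym (label-nonmember (¬mx ∘ λ my → Member-~ my (~-sym x~y)))))

  merged-~-member : ∀ {x y} → Member b x → x M.~ y → Member b y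
  merged-~-member mx x~y = [ Member-~ mx , proj₂ ]′ (Equivalence.to merged-~ x~y)

  merged-~-nonmember : ∀ {x y} → ¬ Member b x → x M.~ y → x ~ y
  merged-~-nonmember ¬mx x~y = [ id , (λ m → contradiction (proj₁ m) ¬mx) ]′ (Equivalence.to merged-~ x~y)

  rep : Fin (suc k) → Fin n
  rep s = fromℕ< (b<n s)

  private
    Member⇔ : ∀ i → Member b (toℕ i) ⇔ (∃ λ s → π i ≡ π (rep s))
    Member⇔ i = mk⇔
      (λ (s , i~b) → s , toℕ-~ i (rep s) (subst (toℕ i ~_) (sym (toℕ-fromℕ< (b<n s))) i~b))
      (λ (s , i≡b) → s , subst (toℕ i ~_) (toℕ-fromℕ< (b<n s)) (~-toℕ i (rep s) i≡b))

  rep-injective : Distinct b → ∀ s s′ → π (rep s) ≡ π (rep s′) → s ≡ s′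
  rep-injective distinct s s′ eq = distinct s s′ (subst₂ _~_ (toℕ-fromℕ< (b<n s)) (toℕ-fromℕ< (b<n s′)) (~-toℕ _ _ eq))

  merged-MergesBlocks : Distinct b → MergesBlocks (suc k) π merged
  merged-MergesBlocks distinct = rep , rep-injective distinct , λ i j → mk⇔ (to i j) (from i j)
    where
      to : ∀ i j → merged i ≡ merged j → _
      to i j eq = ⊎-map (toℕ-~ i j) (×-map (Equivalence.to (Member⇔ i)) (Equivalence.to (Member⇔ j)))
                    (Equivalence.to merged-~ (M.~-toℕ i j eq))
      from : ∀ i j → _ → merged i ≡ merged j
      from i j related = M.toℕ-~ i j (Equivalence.from merged-~
        (⊎-map (~-toℕ i j) (×-map (Equivalence.from (Member⇔ i)) (Equivalence.from (Member⇔ j))) related))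

  Refines-merged : Refines π merged
  Refines-merged i j eq = M.toℕ-~ i j (Equivalence.from merged-~ (inj₁ (~-toℕ i j eq)))

  merged-Refines : ∀ {σ : Partition n} → Refines π σ → (∀ s s′ → OnNat._~_ σ (b s) (b s′)) → Refines merged σ
  merged-Refines {σ} π≤σ sameσ i j eq with Equivalence.to merged-~ (M.~-toℕ i j eq)
  ... | inj₁ i~j = π≤σ i j (toℕ-~ i j i~j)
  ... | inj₂ ((s , i~b) , (s′ , j~b)) = S.toℕ-~ i j (S.~-trans (Refines⇒~ π≤σ i~b) (S.~-trans (sameσ s s′) (S.~-sym (Refines⇒~ π≤σ j~b))))
    where module S = OnNat σ

  merged-≰ : Distinct b → ∀ {s s′} → s ≢ s′ → ¬ Refines merged π
  merged-≰ distinct {s} {s′} s≢s′ merged≤π = s≢s′ (rep-injective distinct s s′ (merged≤π (rep s) (rep s′)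
    (M.toℕ-~ _ _ (Equivalence.from merged-~ (inj₂ ((s , cong label (toℕ-fromℕ< (b<n s))) , (s′ , cong label (toℕ-fromℕ< (b<n s′)))))))))

  module _ (nc : NoncrossingOnℕ) (ones : ModularBlocks.BlocksOneMod d π) (aligned : ModularBlocks.BlocksAligned d π)
           (n≡1 : n ≡ 1 mod d) (k+1≡1 : suc k ≡ 1 mod d) (distinct : Distinct b) (mergeable : Mergeable b) where
    private
      module B = ModularBlocks d π
      module MB = ModularBlocks d merged

    enclosingGap : ∀ {a p c} → a < p → p < c → Member b a → Member b c → ¬ Member b p →
                   ∃₂ λ x y → x < p × p < y × a ≤ x × y ≤ c × Closed (suc x) y
    enclosingGap {a} {p} {c} a<p p<c ma mc ¬mp with Search.greatest< (Member? b) p | Search.least< (λ z → (p <? z) ×-dec Member? b z) (suc c)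
    ... | inj₁ none | _         = contradiction ma (none a a<p)
    ... | _         | inj₁ none = contradiction (p<c , mc) (none c ≤-refl)
    ... | inj₂ before | inj₂ after = x , y , x<p , p<y , Greatest.≤max before a<p ma , ≤-pred y≤c ,
                                     proj₁ (mergeable x y (<-trans x<p p<y) mx my (between-neighbours before after ¬mp))
      where
        open Greatest before using () renaming (max to x; P-max to mx; max< to x<p)
        open Least after using () renaming (min to y; min< to y≤c)
        p<y : p < y
        p<y = proj₁ (Least.P-min after)
        my : Member b y
        my = proj₂ (Least.P-min after)

    merged-noncrossing : M.NoncrossingOnℕ
    merged-noncrossing a e c f a<e e<c c<f a~c e~f with Member? b a | Member? b e
    ... | yes ma | yes me = Equivalence.from merged-~ (inj₂ (ma , me))
    ... | no ¬ma | no ¬me = Equivalence.from merged-~ (inj₁ (nc a e c f a<e e<c c<f (merged-~-nonmember ¬ma a~c) (merged-~-nonmember ¬me e~f)))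
    ... | yes ma | no ¬me =
      let x , y , x<e , e<y , _ , y≤c , gap = enclosingGap a<e e<c ma (merged-~-member ma a~c) ¬me
      in ⊥-elim (<⇒≱ (<-trans c<f (proj₂ (gap e f (merged-~-nonmember ¬me e~f) x<e e<y))) y≤c)
    ... | no ¬ma | yes me =
      let x , y , x<c , c<y , e≤x , _ , gap = enclosingGap e<c c<f me (merged-~-member me e~f) (¬ma ∘ λ mc → merged-~-member mc (M.~-sym a~c))
      in ⊥-elim (<⇒≱ (s≤s (≤-trans (<⇒≤ a<e) e≤x)) (proj₁ (gap c a (~-sym (merged-~-nonmember ¬ma a~c)) x<c c<y)))

    merged-blocksOne : MB.BlocksOneMod
    merged-blocksOne x x<n with Member? b x
    ... | yes mx = ≡-mod-trans
      (≡⇒≡-mod (count-cong (M._~? x) (Member? b) 0 n λ z _ _ → mk⇔ (λ z~x → merged-~-member mx (M.~-sym z~x)) λ mz → Equivalence.from merged-~ (inj₂ (mz , mx))))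
      (≡-mod-trans (memberCount ones (suc k) b b<n distinct) k+1≡1)
    ... | no ¬mx = ≡-mod-trans
      (≡⇒≡-mod (count-cong (M._~? x) (_~? x) 0 n λ z _ _ → mk⇔ (λ z~x → ~-sym (merged-~-nonmember ¬mx (M.~-sym z~x))) (Equivalence.from merged-~ ∘ inj₁)))
      (ones x x<n)

    merged-aligned : MB.BlocksAligned
    merged-aligned = MB.alignment-induction λ {x} {y} (x<y , x~y , between) _ → case Member? b x of λ where
      (yes mx) → proj₂ (mergeable x y x<y mx (merged-~-member mx x~y) λ z x<z z<y mz →
                   between z x<z z<y (Equivalence.from merged-~ (inj₂ (mz , mx))))
      (no ¬mx) → B.Aligned⇒consecutive (x<y , merged-~-nonmember ¬mx x~y , λ z x<z z<y z~x → between z x<z z<y (Equivalence.from merged-~ (inj₁ z~x)))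
                   (aligned x y x<y (merged-~-nonmember ¬mx x~y))

    merged-NCd : NCd d n merged
    merged-NCd = MB.properties⇒NCd merged-noncrossing merged-blocksOne merged-aligned n≡1

module Chains (d : ℕ) {n : ℕ} {π σ : Partition n}
              (πP : ModularBlocks.NCdProperties d π) (σP : ModularBlocks.NCdProperties d σ)
              (π≤σ : Refines π σ) (s₀ : ℕ) where
  open OnNat π
  open ModularBlocks d π using (Consecutive; BlockHull)
  open ModularBlocks.NCdProperties πP
  open Members d π
  private
    module S = OnNat σ
    module σP = ModularBlocks.NCdProperties σP

  InS : ℕ → Set
  InS z = z S.~ s₀

  InS? : Decidable InS
  InS? z = z S.~? s₀

  Member⇒InS : ∀ {m} {rep : Fin m → ℕ} → (∀ i → InS (rep i)) → ∀ {z} → Member rep z → InS z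
  Member⇒InS rep∈S (i , z~rep) = S.~-trans (Refines⇒~ π≤σ z~rep) (rep∈S i)

  S-gap : ∀ {x y} → x < y → InS x → InS y → (∀ z → x < z → z < y → ¬ InS z) → Closed (suc x) y × y ≡ suc x mod d
  S-gap x<y x∈S y∈S none =
    let closed , y≡ = σP.consecutive-gap (x<y , S.~-trans x∈S (S.~-sym y∈S) , λ z x<z z<y z~x → none z x<z z<y (S.~-trans z~x x∈S))
    in Refines⇒Closed π≤σ closed , y≡

  block-gap : ∀ {x y u} → x < y → x ~ u → y ~ u → (∀ z → x < z → z < y → ¬ z ~ u) → Closed (suc x) y × y ≡ suc x mod d
  block-gap x<y x~u y~u none = consecutive-gap (x<y , ~-trans x~u (~-sym y~u) , λ z x<z z<y z~x → none z x<z z<y (~-trans z~x x~u))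

  record MergeableBlocksInS (k : ℕ) : Set where
    field
      rep       : Fin k → ℕ
      rep<n     : ∀ i → rep i < n
      distinct  : Distinct rep
      rep∈S     : ∀ i → InS (rep i)
      mergeable : Mergeable rep

  module Segment (u₀ β : ℕ) (u₀∈S : InS u₀) (u₀<β : u₀ < β) (β≤n : β ≤ n)
           (separated : ∀ z → InS z → z < u₀ → ∀ w → u₀ ≤ w → w < β → ¬ z ~ w)
           (bounded : ∀ x y → x ~ y → u₀ ≤ x → x < β → y < β) where

    record Chain (t : ℕ) : Set where
      field
        rep         : Fin (suc t) → ℕ
        rep<n       : ∀ i → rep i < n
        distinct    : Distinct rep
        rep∈S       : ∀ i → InS (rep i)
        last        : ℕ
        last-member : Member rep last
        ≤last       : ∀ z → Member rep z → z ≤ last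
        u₀-member   : Member rep u₀
        u₀≤         : ∀ z → Member rep z → u₀ ≤ z
        last<β      : last < β
        closed      : Closed u₀ (suc last)
        last≡       : last ≡ u₀ + t mod d
        mergeable   : Mergeable rep

      last∈S : InS last
      last∈S = Member⇒InS rep∈S last-member

    NextInS : ∀ {t} → Chain t → Set
    NextInS c = Least (λ z → Chain.last c < z × InS z) β

    chain₀ : Chain 0
    chain₀ = record
      { rep = λ _ → u₀ ; rep<n = λ _ → u₀<n ; distinct = λ { fz fz _ → refl } ; rep∈S = λ _ → u₀∈S
      ; last = H.last ; last-member = fz , H.last~u ; ≤last = λ z → H.≤last z ∘ proj₂
      ; u₀-member = fz , refl ; u₀≤ = λ z → least≤ ∘ proj₂
      ; last<β = bounded u₀ H.last (~-sym H.last~u) ≤-refl u₀<β ; closed = H.closed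
      ; last≡ = ≡-mod-trans (hull-last≡ hull₀) (≡⇒≡-mod (sym (+-identityʳ u₀)))
      ; mergeable = λ x y x<y mx my none → block-gap x<y (proj₂ mx) (proj₂ my) λ z x<z z<y z~u₀ → none z x<z z<y (fz , z~u₀)
      }
      where
        u₀<n : u₀ < n
        u₀<n = <-≤-trans u₀<β β≤n
        u₀-least : NoneBelow (_~ u₀) u₀
        u₀-least z z<u₀ z~u₀ = separated z (S.~-trans (Refines⇒~ π≤σ z~u₀) u₀∈S) z<u₀ u₀ ≤-refl u₀<β z~u₀
        least≤ : ∀ {z} → z ~ u₀ → u₀ ≤ z
        least≤ {z} z~u₀ = ≮⇒≥ λ z<u₀ → u₀-least z z<u₀ z~u₀
        hull₀ : BlockHull noncrossing blocksOne u₀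
        hull₀ = hull u₀<n u₀-least
        module H = BlockHull hull₀

    -- The next block of the chain is that of the first element u of S after the current last one.
    module Extension {t} (c : Chain t) (next : NextInS c) where
      open Chain c
      open Least next using (below-min) renaming (min to u; min< to u<β)
      last<u : last < u
      last<u = proj₁ (Least.P-min next)
      u∈S : InS u
      u∈S = proj₂ (Least.P-min next)
      u<n : u < n
      u<n = <-≤-trans u<β β≤n
      u₀≤u : u₀ ≤ u
      u₀≤u = ≤-trans (u₀≤ last last-member) (<⇒≤ last<u)
      gap : Closed (suc last) u × u ≡ suc last mod d
      gap = S-gap last<u last∈S u∈S λ z last<z z<u z∈S → below-min z z<u (last<z , z∈S)

      u-least : NoneBelow (_~ u) u
      u-least z z<u z~u with z <? u₀ | z ≤? last
      ... | yes z<u₀ | _ = separated z (S.~-trans (Refines⇒~ π≤σ z~u) u∈S) z<u₀ u u₀≤u u<β z~u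
      ... | no z≮u₀ | yes z≤last = <⇒≱ last<u (≤-pred (proj₂ (closed z u z~u (≮⇒≥ z≮u₀) (s≤s z≤last))))
      ... | no _    | no z≰last = below-min z z<u (≰⇒> z≰last , S.~-trans (Refines⇒~ π≤σ z~u) u∈S)
      u≤ : ∀ {z} → z ~ u → u ≤ z
      u≤ {z} z~u = ≮⇒≥ λ z<u → u-least z z<u z~u
      hull′ : BlockHull noncrossing blocksOne u
      hull′ = hull u<n u-least
      module H = BlockHull hull′

      rep′ : Fin (suc (suc t)) → ℕ
      rep′ fz = u
      rep′ (fs i) = rep i
      rep′<n : ∀ i → rep′ i < n
      rep′<n fz = u<n
      rep′<n (fs i) = rep<n i
      rep′∈S : ∀ i → InS (rep′ i)
      rep′∈S fz = u∈S
      rep′∈S (fs i) = rep∈S i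

      split : ∀ {z} → Member rep′ z → z ~ u ⊎ Member rep z
      split (fz , z~u) = inj₁ z~u
      split (fs i , z~rep) = inj₂ (i , z~rep)
      old : ∀ {z} → Member rep z → Member rep′ z
      old (i , z~rep) = fs i , z~rep
      u∉old : ¬ Member rep u
      u∉old mu = <⇒≱ last<u (≤last u mu)

      distinct′ : Distinct rep′
      distinct′ fz fz _ = refl
      distinct′ fz (fs i) u~rep = contradiction (i , u~rep) u∉old
      distinct′ (fs i) fz rep~u = contradiction (i , ~-sym rep~u) u∉old
      distinct′ (fs i) (fs i′) rep~rep = cong fs (distinct i i′ rep~rep)

      ≤last′ : ∀ z → Member rep′ z → z ≤ H.last
      ≤last′ z m = [ H.≤last z , (λ mz → ≤-trans (≤last z mz) (≤-trans (<⇒≤ last<u) H.u≤last)) ]′ (split m)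
      u₀≤′ : ∀ z → Member rep′ z → u₀ ≤ z
      u₀≤′ z m = [ (λ z~u → ≤-trans u₀≤u (u≤ z~u)) , u₀≤ z ]′ (split m)

      mergeable′ : Mergeable rep′
      mergeable′ x y x<y mx my none with split mx | split my
      ... | inj₁ x~u | inj₁ y~u = block-gap x<y x~u y~u λ z x<z z<y z~u → none z x<z z<y (fz , z~u)
      ... | inj₁ x~u | inj₂ my′ = ⊥-elim (<⇒≱ x<y (≤-trans (≤last y my′) (≤-trans (<⇒≤ last<u) (u≤ x~u))))
      ... | inj₂ mx′ | inj₂ my′ = mergeable x y x<y mx′ my′ λ z x<z z<y mz → none z x<z z<y (old mz)
      ... | inj₂ mx′ | inj₁ y~u with m≤n⇒m<n∨m≡n (≤last x mx′) | m≤n⇒m<n∨m≡n (u≤ y~u)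
      ...   | inj₁ x<last | _           = ⊥-elim (none last x<last (<-≤-trans last<u (u≤ y~u)) (old last-member))
      ...   | inj₂ refl   | inj₁ u<y    = ⊥-elim (none u last<u u<y (fz , refl))
      ...   | inj₂ refl   | inj₂ refl   = gap

      last′≡ : H.last ≡ u₀ + suc t mod d
      last′≡ = begin
        H.last       ≈⟨ hull-last≡ hull′ ⟩
        u            ≈⟨ proj₂ gap ⟩
        suc last     ≈⟨ +-cong-mod (≡-mod-refl {a = 1}) last≡ ⟩
        suc (u₀ + t) ≡⟨ +-suc u₀ t ⟨
        u₀ + suc t   ∎
        where open ≡-mod-Reasoning

      extended : Chain (suc t)
      extended = record
        { rep = rep′ ; rep<n = rep′<n ; distinct = distinct′ ; rep∈S = rep′∈S
        ; last = H.last ; last-member = fz , H.last~u ; ≤last = ≤last′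
        ; u₀-member = fs (proj₁ u₀-member) , proj₂ u₀-member ; u₀≤ = u₀≤′
        ; last<β = bounded u H.last (~-sym H.last~u) u₀≤u u<β
        ; closed = Closed-∪ u₀≤u (≤-trans H.u≤last (n≤1+n _))
                     (Closed-∪ (≤-trans (u₀≤ last last-member) (n≤1+n last)) last<u closed (proj₁ gap)) H.closed
        ; last≡ = last′≡
        ; mergeable = mergeable′
        }

    extend : ∀ {t} (c : Chain t) → NextInS c → Chain (suc t)
    extend = Extension.extended

    last~u₀ : ∀ {t} (c : Chain t) → t ≡ 0 → Chain.last c ~ u₀
    last~u₀ c refl with Chain.last-member c | Chain.u₀-member c
    ... | fz , last~r | fz , u₀~r = ~-trans last~r (~-sym u₀~r)

    chain⇒blocks : ∀ {t} → Chain t → MergeableBlocksInS (suc t)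
    chain⇒blocks c = record { Chain c }

    grow : ∀ T → (∀ {t} → t < T → (c : Chain t) → NextInS c) → Chain T
    grow zero    next = chain₀
    grow (suc T) next = extend chain (next ≤-refl chain)
      where
        chain : Chain T
        chain = grow T λ t<T → next (m<n⇒m<1+n t<T)

module Existence (d : ℕ) {n : ℕ} {π σ : Partition n}
                 (πP : ModularBlocks.NCdProperties d π) (σP : ModularBlocks.NCdProperties d σ)
                 (π≤σ : Refines π σ) {i j : ℕ} (i<n : i < n) (i~j : OnNat._~_ σ i j) (i≁j : ¬ OnNat._~_ π i j) where
  open OnNat π
  module S = OnNat σ
  open ModularBlocks.NCdProperties πP
  module σP = ModularBlocks.NCdProperties σP
  open Members d π
  open Chains d πP σP π≤σ i

  first : Least InS (suc i)
  first = Search.least InS? refl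

  open Least first using () renaming (min to smin; P-min to smin∈S; min≤ to smin≤; below-min to below-smin)

  smin<n : smin < n
  smin<n = ≤-<-trans (≤-pred (Least.min< first)) i<n

  σhull : ModularBlocks.BlockHull d σ σP.noncrossing σP.blocksOne smin
  σhull = σP.hull smin<n λ z z<smin z~smin → below-smin z z<smin (S.~-trans z~smin smin∈S)

  open ModularBlocks.BlockHull σhull using () renaming (last to smax; last<n to smax<n)

  smax∈S : InS smax
  smax∈S = S.~-trans (ModularBlocks.BlockHull.last~u σhull) smin∈S

  ≤smax : ∀ {z} → InS z → z ≤ smax
  ≤smax {z} z∈S = ModularBlocks.BlockHull.≤last σhull z (S.~-trans z∈S (S.~-sym smin∈S))

  -- If the extreme elements of S lie in different π-blocks, a chain of d + 1 blocks starting at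
  -- min S cannot stop early: it would have to end at max S, and max S ≡ min S.
  module ExtremesApart (smax≁smin : ¬ smax ~ smin) where

    separated : ∀ z → InS z → z < smin → ∀ w → smin ≤ w → w < n → ¬ z ~ w
    separated z z∈S z<smin _ _ _ _ = below-smin z z<smin z∈S

    bounded : ∀ x y → x ~ y → smin ≤ x → x < n → y < n
    bounded x y x~y _ x<n = ~-<n x<n x~y

    open Segment smin n smin∈S smin<n ≤-refl separated bounded

    next : ∀ {t} → t < d → (c : Chain t) → NextInS c
    next {t} t<d c with Search.least< (λ z → (Chain.last c <? z) ×-dec InS? z) n
    ... | inj₂ l    = l
    ... | inj₁ none = ⊥-elim (<⇒≱ t<d (≡0-mod⇒d≤ (n≢0⇒n>0 t≢0) t≡0))
      where
        open Chain c using (last; last≡; last∈S)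
        last≡smax : last ≡ smax
        last≡smax = ≤-antisym (≤smax last∈S) (≮⇒≥ λ last<smax → none smax smax<n (last<smax , smax∈S))
        t≡0 : t ≡ 0 mod d
        t≡0 = +-cancelˡ-mod smin (begin
          smin + t ≈⟨ last≡ ⟨
          last     ≡⟨ last≡smax ⟩
          smax     ≈⟨ σP.hull-last≡ σhull ⟩
          smin     ≡⟨ +-identityʳ smin ⟨
          smin + 0 ∎)
          where open ≡-mod-Reasoning
        t≢0 : t ≢ 0
        t≢0 t≡0 = smax≁smin (subst (_~ smin) last≡smax (last~u₀ c t≡0))

    blocks : MergeableBlocksInS (suc d)
    blocks = chain⇒blocks (grow d next)

  -- Otherwise the block B of min S also contains max S. Pick p ∈ S outside B and let c < p < c′ be
  -- the neighbours of p in B. Between them, a chain of d blocks of S starts at the first element u₀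
  -- of S after c; it cannot reach c′ early since c′ ≡ c + 1. Together with B these are d + 1 blocks.
  record Window : Set where
    field
      c c′ u₀ : ℕ
      c~smin  : c ~ smin
      c′~smin : c′ ~ smin
      c<u₀    : c < u₀
      u₀<c′   : u₀ < c′
      c′<n    : c′ < n
      u₀∈S    : InS u₀
      B-none  : ∀ z → c < z → z < c′ → ¬ z ~ smin
      S-none  : ∀ z → c < z → z < u₀ → ¬ InS z

  module ExtremesTogether (smax~smin : smax ~ smin) where

    outside : ∃ λ p → InS p × ¬ p ~ smin × p < n
    outside with i ~? smin
    ... | yes i~smin = j , S.~-sym i~j , (λ j~smin → i≁j (~-trans i~smin (~-sym j~smin))) , S.~-<n i<n i~j
    ... | no i≁smin  = i , refl , i≁smin , i<n

    p : ℕ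
    p = proj₁ outside
    p∈S : InS p
    p∈S = proj₁ (proj₂ outside)
    p≁smin : ¬ p ~ smin
    p≁smin = proj₁ (proj₂ (proj₂ outside))
    p<n : p < n
    p<n = proj₂ (proj₂ (proj₂ outside))

    smin<p : smin < p
    smin<p = ≤∧≢⇒< (smin≤ p∈S) λ smin≡p → p≁smin (cong label (sym smin≡p))

    p<smax : p < smax
    p<smax = ≤∧≢⇒< (≤smax p∈S) λ p≡smax → p≁smin (subst (_~ smin) (sym p≡smax) smax~smin)

    before : Greatest (_~ smin) p
    before = [ (λ none → contradiction refl (none smin smin<p)) , id ]′ (Search.greatest< (_~? smin) p)

    after : Least (λ z → p < z × z ~ smin) n
    after = [ (λ none → contradiction (p<smax , smax~smin) (none smax smax<n)) , id ]′
              (Search.least< (λ z → (p <? z) ×-dec (z ~? smin)) n)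
    c : ℕ
    c = Greatest.max before
    c′ : ℕ
    c′ = Least.min after
    c<p : c < p
    c<p = Greatest.max< before
    p<c′ : p < c′
    p<c′ = proj₁ (Least.P-min after)

    B-none : ∀ z → c < z → z < c′ → ¬ z ~ smin
    B-none = between-neighbours before after p≁smin

    first-after-c : Least (λ z → c < z × InS z) n
    first-after-c = [ (λ none → contradiction (c<p , p∈S) (none p p<n)) , id ]′
                      (Search.least< (λ z → (c <? z) ×-dec InS? z) n)

    u₀ : ℕ
    u₀ = Least.min first-after-c
    c<u₀ : c < u₀
    c<u₀ = proj₁ (Least.P-min first-after-c)
    u₀∈S : InS u₀
    u₀∈S = proj₂ (Least.P-min first-after-c)

    u₀<c′ : u₀ < c′
    u₀<c′ = ≤-<-trans (Least.min≤ first-after-c (c<p , p∈S)) p<c′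

    window : Window
    window = record
      { c = c ; c′ = c′ ; u₀ = u₀ ; c~smin = Greatest.P-max before ; c′~smin = proj₂ (Least.P-min after)
      ; c<u₀ = c<u₀ ; u₀<c′ = u₀<c′ ; c′<n = Least.min< after ; u₀∈S = u₀∈S ; B-none = B-none
      ; S-none = λ z c<z z<u₀ z∈S → Least.below-min first-after-c z z<u₀ (c<z , z∈S)
      }

  module InWindow (w : Window) {d′ : ℕ} (d≡1+d′ : d ≡ suc d′) where
    open Window w

    c-gap : Closed (suc c) c′ × c′ ≡ suc c mod d
    c-gap = block-gap (<-trans c<u₀ u₀<c′) c~smin c′~smin B-none

    c∈S : InS c
    c∈S = S.~-trans (Refines⇒~ π≤σ c~smin) smin∈S

    u₀-gap : Closed (suc c) u₀ × u₀ ≡ suc c mod d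
    u₀-gap = S-gap c<u₀ c∈S u₀∈S S-none

    separated : ∀ z → InS z → z < u₀ → ∀ w → u₀ ≤ w → w < c′ → ¬ z ~ w
    separated z z∈S z<u₀ w u₀≤w w<c′ z~w = B-none w c<w w<c′ (~-trans (~-sym z~w) z~smin)
      where
        c<w : c < w
        c<w = <-≤-trans c<u₀ u₀≤w
        z~smin : z ~ smin
        z~smin with m≤n⇒m<n∨m≡n (≮⇒≥ λ c<z → S-none z c<z z<u₀ z∈S)
        ... | inj₂ refl = c~smin
        ... | inj₁ z<c  = ~-trans (noncrossing z c w c′ z<c c<w w<c′ z~w (~-trans c~smin (~-sym c′~smin))) c~smin

    bounded : ∀ x y → x ~ y → u₀ ≤ x → x < c′ → y < c′
    bounded x y x~y u₀≤x x<c′ = proj₂ (proj₁ c-gap x y x~y (≤-trans c<u₀ u₀≤x) x<c′)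

    open Segment u₀ c′ u₀∈S u₀<c′ (<⇒≤ c′<n) separated bounded

    next : ∀ {t} → t < d′ → (ch : Chain t) → NextInS ch
    next {t} t<d′ ch with Search.least< (λ z → (Chain.last ch <? z) ×-dec InS? z) (suc c′)
    ... | inj₁ none = contradiction (Chain.last<β ch , S.~-trans (Refines⇒~ π≤σ c′~smin) smin∈S) (none c′ ≤-refl)
    ... | inj₂ l with m<1+n⇒m<n∨m≡n (Least.min< l)
    ...   | inj₁ u<c′ = record { Least l ; min< = u<c′ }
    ...   | inj₂ u≡c′ = ⊥-elim (<⇒≱ (subst (suc t <_) (sym d≡1+d′) (s≤s t<d′)) (≡0-mod⇒d≤ z<s 1+t≡0))
      where
        open Chain ch using (last; last≡; last∈S)
        c′≡1+last : c′ ≡ suc last mod d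
        c′≡1+last = subst (λ u → u ≡ suc last mod d) u≡c′
          (proj₂ (S-gap (proj₁ (Least.P-min l)) last∈S (proj₂ (Least.P-min l)) λ z last<z z<u z∈S → Least.below-min l z z<u (last<z , z∈S)))
        1+t≡0 : suc t ≡ 0 mod d
        1+t≡0 = +-cancelˡ-mod (suc c) (begin
          suc c + suc t ≈⟨ +-cong-mod (proj₂ u₀-gap) ≡-mod-refl ⟨
          u₀ + suc t    ≡⟨ +-suc u₀ t ⟩
          suc (u₀ + t)  ≈⟨ +-cong-mod (≡-mod-refl {a = 1}) last≡ ⟨
          suc last      ≈⟨ c′≡1+last ⟨
          c′            ≈⟨ proj₂ c-gap ⟩
          suc c         ≡⟨ +-identityʳ (suc c) ⟨
          suc c + 0     ∎)
          where open ≡-mod-Reasoning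

    chain : Chain d′
    chain = grow d′ next

    open Chain chain using (rep; last; last-member; ≤last; u₀-member; u₀≤; last<β; last≡)

    rep′ : Fin (suc (suc d′)) → ℕ
    rep′ fz = c
    rep′ (fs k) = rep k

    split : ∀ {z} → Member rep′ z → z ~ c ⊎ Member rep z
    split (fz , z~c) = inj₁ z~c
    split (fs k , z~rep) = inj₂ (k , z~rep)

    old : ∀ {z} → Member rep z → Member rep′ z
    old (k , z~rep) = fs k , z~rep

    c-member : ∀ {z} → z ~ c → Member rep′ z
    c-member z~c = fz , z~c

    B-outside-chain : ∀ {z} → z ~ c → ¬ Member rep z
    B-outside-chain {z} z~c mz = B-none z (<-≤-trans c<u₀ (u₀≤ z mz)) (≤-<-trans (≤last z mz) last<β) (~-trans z~c c~smin)

    last-gap : Closed (suc last) c′ × c′ ≡ suc last mod d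
    last-gap = Closed-∖ˡ (s≤s (≤-trans (<⇒≤ c<u₀) (u₀≤ last last-member))) (proj₁ c-gap)
                 (Closed-∪ c<u₀ (≤-trans (u₀≤ last last-member) (n≤1+n last)) (proj₁ u₀-gap) (Chain.closed chain)) ,
               (begin
                 c′              ≈⟨ proj₂ c-gap ⟩
                 suc c           ≡⟨ +-identityʳ (suc c) ⟨
                 suc c + 0       ≈⟨ +-cong-mod (≡-mod-refl {a = suc c}) (subst (_≡ 0 mod d) d≡1+d′ d≡0-mod) ⟨
                 suc c + suc d′  ≈⟨ +-cong-mod (proj₂ u₀-gap) ≡-mod-refl ⟨
                 u₀ + suc d′     ≡⟨ +-suc u₀ d′ ⟩
                 suc (u₀ + d′)   ≈⟨ +-cong-mod (≡-mod-refl {a = 1}) last≡ ⟨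
                 suc last        ∎)
      where open ≡-mod-Reasoning

    mergeable′ : Mergeable rep′
    mergeable′ x y x<y mx my none with split mx | split my
    ... | inj₁ x~c  | inj₁ y~c  = block-gap x<y x~c y~c λ z x<z z<y z~c → none z x<z z<y (c-member z~c)
    ... | inj₂ mx′  | inj₂ my′  = Chain.mergeable chain x y x<y mx′ my′ λ z x<z z<y mz → none z x<z z<y (old mz)
    ... | inj₁ x~c  | inj₂ my′  = subst₂ (λ a b → Closed (suc a) b × b ≡ suc a mod d) (sym x≡c) (sym y≡u₀) u₀-gap
      where
        x≤c : x ≤ c
        x≤c = ≮⇒≥ λ c<x → B-none x c<x (<-trans x<y (≤-<-trans (≤last y my′) last<β)) (~-trans x~c c~smin)
        x≡c : x ≡ c
        x≡c = ≤-antisym x≤c (≮⇒≥ λ x<c → none c x<c (<-≤-trans c<u₀ (u₀≤ y my′)) (c-member refl))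
        y≡u₀ : y ≡ u₀
        y≡u₀ = ≤-antisym (≮⇒≥ λ u₀<y → none u₀ (≤-<-trans x≤c c<u₀) u₀<y (old u₀-member)) (u₀≤ y my′)
    ... | inj₂ mx′  | inj₁ y~c  = subst₂ (λ a b → Closed (suc a) b × b ≡ suc a mod d) (sym x≡last) (sym y≡c′) last-gap
      where
        x<c′ : x < c′
        x<c′ = ≤-<-trans (≤last x mx′) last<β
        c′≤y : c′ ≤ y
        c′≤y = ≮⇒≥ λ y<c′ → B-none y (<-≤-trans c<u₀ (≤-trans (u₀≤ x mx′) (<⇒≤ x<y))) y<c′ (~-trans y~c c~smin)
        y≡c′ : y ≡ c′
        y≡c′ = ≤-antisym (≮⇒≥ λ c′<y → none c′ x<c′ c′<y (c-member (~-trans c′~smin (~-sym c~smin)))) c′≤y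
        x≡last : x ≡ last
        x≡last = ≤-antisym (≤last x mx′) (≮⇒≥ λ x<last → none last x<last (<-≤-trans last<β c′≤y) (old last-member))

    blocks : MergeableBlocksInS (suc d)
    blocks = subst MergeableBlocksInS (cong suc (sym d≡1+d′)) record
      { rep = rep′ ; rep<n = rep′<n ; distinct = distinct′ ; rep∈S = rep′∈S ; mergeable = mergeable′ }
      where
        rep′<n : ∀ k → rep′ k < n
        rep′<n fz = <-trans c<u₀ (<-trans u₀<c′ c′<n)
        rep′<n (fs k) = Chain.rep<n chain k
        rep′∈S : ∀ k → InS (rep′ k)
        rep′∈S fz = c∈S
        rep′∈S (fs k) = Chain.rep∈S chain k
        distinct′ : Distinct rep′
        distinct′ fz fz _ = refl
        distinct′ fz (fs k) c~rep = ⊥-elim (B-outside-chain ~-refl (k , c~rep))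
        distinct′ (fs k) fz rep~c = ⊥-elim (B-outside-chain rep~c (k , ~-refl))
        distinct′ (fs k) (fs k′) rep~rep = cong fs (Chain.distinct chain k k′ rep~rep)

  mergeableBlocks : 1 ≤ d → MergeableBlocksInS (suc d)
  mergeableBlocks 1≤d with smax ~? smin
  ... | no smax≁smin = ExtremesApart.blocks smax≁smin
  ... | yes smax~smin = InWindow.blocks (ExtremesTogether.window smax~smin) (sym (suc-pred d {{>-nonZero 1≤d}}))

MergesBlocks-resp : ∀ {n k} {π σ τ : Partition n} → Refines σ τ → Refines τ σ → MergesBlocks k π τ → MergesBlocks k π σ
MergesBlocks-resp σ≤τ τ≤σ (rep , rep-injective , blocks) =
  rep , rep-injective , λ i j → mk⇔ (Equivalence.to (blocks i j) ∘ σ≤τ i j) (τ≤σ i j ∘ Equivalence.from (blocks i j))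

¬Refines⇒separated : ∀ {n} {π σ : Partition n} → ¬ Refines σ π → ∃₂ λ i j → σ i ≡ σ j × π i ≢ π j
¬Refines⇒separated {n} {π} {σ} σ≰π with all? (λ i → all? λ j → (σ i ≟ σ j) →-dec (π i ≟ π j))
... | yes σ≤π = contradiction σ≤π σ≰π
... | no σ≰π′ with ¬∀⟶∃¬ n _ (λ i → all? λ j → (σ i ≟ σ j) →-dec (π i ≟ π j)) σ≰π′
...   | i , ¬all with ¬∀⟶∃¬ n _ (λ j → (σ i ≟ σ j) →-dec (π i ≟ π j)) ¬all
...     | j , ¬implies with σ i ≟ σ j
...       | yes σij = i , j , σij , λ πij → ¬implies λ _ → πij
...       | no ¬σij = contradiction (λ σij → contradiction σij ¬σij) ¬implies

corollary3p10 : (d n : ℕ) → 1 ≤ d → (π σ : Partition n) →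
    Covers d n π σ → MergesBlocks (suc d) π σ
corollary3p10 d@(suc _) n 1≤d π σ (πNCd , σNCd , (π≤σ , σ≰π) , covering) with ¬Refines⇒separated σ≰π
... | i , j , σij , πij = MergesBlocks-resp σ≤τ τ≤σ (τ.merged-MergesBlocks distinct)
  where
    open OnNat π
    module S = OnNat σ
    πP : ModularBlocks.NCdProperties d π
    πP = ModularBlocks.NCd⇒properties d π πNCd
    σP : ModularBlocks.NCdProperties d σ
    σP = ModularBlocks.NCd⇒properties d σ σNCd
    open ModularBlocks.NCdProperties πP
    open Chains.MergeableBlocksInS (Existence.mergeableBlocks d πP σP π≤σ (toℕ<n i) (S.~-toℕ i j σij) (πij ∘ toℕ-~ i j) 1≤d)
    module τ = Merge d π rep rep<n
    τNCd : NCd d n τ.merged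
    τNCd = τ.merged-NCd noncrossing blocksOne aligned
             (ModularBlocks.n≡1 d π noncrossing blocksOne aligned dualBlocksOne (≤-<-trans z≤n (toℕ<n i)))
             (+-cong-mod (≡-mod-refl {a = 1}) d≡0-mod) distinct mergeable
    τ≤σ : Refines τ.merged σ
    τ≤σ = τ.merged-Refines π≤σ λ s s′ → S.~-trans (rep∈S s) (S.~-sym (rep∈S s′))
    σ≤τ : Refines σ τ.merged
    σ≤τ = [ (λ τ≤π → contradiction τ≤π (τ.merged-≰ distinct {fz} {fs fz} λ ())) , id ]′ (covering τ.merged τNCd τ.Refines-merged τ≤σ)
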